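{- Let $\mathcal H$ be a nice operator. For every operator form $\varphi$ and every $\mathcal L_{\mathsf{ID}}$-formula $\psi(x)$ (with at most $x$ free) there is $n\prec\omega$ such that $\mathcal H\vdash^{\Omega\cdot2+n}_0\forall x\in\mathbb N\,\big(\varphi(x,\psi^+)\to\psi^+(x)\big)\to\forall x\in\mathbb N\,\big(I^{\prec\Omega}_\varphi x\to\psi^+(x)\big)$, where $\Omega\cdot2$ denotes $\Omega+\Omega$.
   Context: Ordinal terms: The set $\vartheta(\varepsilon_{\Omega+1})$ of terms, a relation $\prec$ and finite sets $E(\alpha)$ are defined by simultaneous recursion on term length: Terms: $\Omega$; $\vartheta\alpha$ for each term $\alpha$; $\langle\alpha_0,\dots,\alpha_{n-1}\rangle$ ($n\ge0$) provided that if $n>1$ then $\alpha_{n-1}\preceq\dots\preceq\alpha_0$ ($\preceq$ is $\prec$ or syntactic equality), and if $n=1$ then $\alpha_0$ is not $\Omega$ or of the form $\vartheta\beta$. $E(\Omega)=\emptyset$, $E(\vartheta\alpha)=\{\vartheta\alpha\}$, $E(\langle\alpha_0,\dots\rangle)=\bigcup_iE(\alpha_i)$. $\alpha\prec\beta$ iff: (1) $\alpha=\Omega$, $\beta=\langle\beta_0,\dots,\beta_{n-1}\rangle$, $n>0$, $\Omega\preceq\beta_0$; or (2) $\alpha=\vartheta\alpha'$ and either $\beta=\Omega$, or $\beta=\langle\beta_0,\dots\rangle$ nonempty with $\alpha\preceq\beta_0$, or $\beta=\vartheta\beta'$ with $\alpha'\prec\beta'$ and $\gamma\prec\beta$ for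 all $\gamma\in E(\alpha')$, or $\beta=\vartheta\beta'$ with $\alpha\preceq\gamma$ for some $\gamma\in E(\beta')$; or (3) $\alpha=\langle\alpha_0,\dots,\alpha_{m-1}\rangle$ and either $\beta\in\{\Omega\}\cup\{\vartheta\beta'\}$ with ($m=0$ or $\alpha_0\prec\beta$), or $\beta=\langle\beta_0,\dots,\beta_{n-1}\rangle$ is lexicographically larger ($\alpha$ a proper initial segment of $\beta$, or first difference $\alpha_j\prec\beta_j$). Numerals: $n:=\langle0,\dots,0\rangle$ ($n$ entries, $0=\langle\rangle$), $\omega:=\langle 1\rangle$. Addition: identify $\Omega,\vartheta\alpha$ with $\langle\Omega\rangle,\langle\vartheta\alpha\rangle$ and set $\langle\alpha_0,\dots,\alpha_{m-1}\rangle+\langle\beta_0,\dots,\beta_{n-1}\rangle=\langle\alpha_0,\dots,\alpha_{k-1},\beta_0,\dots,\beta_{n-1}\rangle$ where $k$ is largest such that $\beta_0\preceq\alpha_{k-1}$ (all of $\alpha$ if $n=0$; $k=0$ if no such); $\omega\cdot\Omega=\Omega$, $\omega\cdot\vartheta\alpha=\vartheta\alpha$, $\omega\cdot\langle\alpha_0,\dots\rangle=\langle1+\alpha_0,\dots\rangle$. Language: formulas are in negation normal form ($\neg$, $\to$ abbreviations). An operator form is a formula $\varphi(x,X)$ of arithmetic with an extra unary predicate $X$, with one free number variable and no subformula $\neg Xt$. $\mathcal L_{\mathsf{ID}}$ extends $\mathcal L_{\mathsf{PA}}$ by a predicate $I_\varphi$ for each operator form. $\mathcal L^\Omega_{\mathsf{ID}}$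 extends $\mathcal L_{\mathsf{PA}}$ by predicates $I^{\prec\alpha}_\varphi$ for each operator form $\varphi$ and term $\alpha\preceq\Omega$; $\psi^+$ is obtained from an $\mathcal L_{\mathsf{ID}}$-formula $\psi$ by replacing each $I_\varphi$ by $I^{\prec\Omega}_\varphi$; $\varphi(t,\theta)$ replaces $x$ by $t$ and each $Xs$ by $\theta(s)$. Each sentence is assigned a disjunction or conjunction: a false $\mathcal L_{\mathsf{PA}}$-literal $\simeq$ empty disjunction; $I^{\prec\alpha}_\varphi t\simeq\bigvee_{\gamma\prec\alpha}\varphi(t,I^{\prec\gamma}_\varphi)$; $\psi_0\lor\psi_1\simeq\bigvee_{i\prec2}\psi_i$; $\exists x\,\psi(x)\simeq\bigvee_{n\prec\omega}\psi(n)$; and $\neg\psi\simeq\bigwedge_{\gamma\prec\alpha}\neg\psi_\gamma$ whenever $\psi\simeq\bigvee_{\gamma\prec\alpha}\psi_\gamma$. Ranks: $\operatorname{rk}=0$ for $\mathcal L_{\mathsf{PA}}$-literals, $\operatorname{rk}(\pm I^{\prec\alpha}_\varphi t)=\omega\cdot\alpha$, $\operatorname{rk}(\psi_0\lor\psi_1)=\operatorname{rk}(\psi_0\land\psi_1)=\max(\operatorname{rk}\psi_0,\operatorname{rk}\psi_1)+1$, $\operatorname{rk}(\exists x\psi)=\operatorname{rk}(\forall x\psi)=\operatorname{rk}(\psi)+1$. $k(\psi)$ is the set of $\alpha$ such that $\psi$ contains a literal $I^{\prec\alpha}_\varphi t$ or $\neg I^{\prec\alpha}_\varphi t$; for a sequent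 (finite set of sentences) $k(\Gamma)=\bigcup_{\psi\in\Gamma}k(\psi)$. Operators: with $\mathcal P$ the powerset of $\vartheta(\varepsilon_{\Omega+1})$, a nice operator is $\mathcal H:\mathcal P\to\mathcal P$ with $X\subseteq\mathcal H(X)$, ($X\subseteq\mathcal H(Y)\Rightarrow\mathcal H(X)\subseteq\mathcal H(Y)$), and ($\alpha\in\mathcal H(X)\Leftrightarrow E(\alpha)\subseteq\mathcal H(X)$); $\mathcal H[Z](X):=\mathcal H(Z\cup X)$. Derivations: $\mathcal H\vdash^\alpha_\rho\Gamma$ is defined by recursion on $\alpha$: it holds iff $\{\alpha\}\cup k(\Gamma)\subseteq\mathcal H(\emptyset)$ and one of: ($\bigwedge$) some $\psi\simeq\bigwedge_{\gamma\prec\delta}\psi_\gamma$ in $\Gamma$ such that for every $\gamma\prec\delta$ there is $\alpha(\gamma)\prec\alpha$ with $\mathcal H[\{\gamma\}]\vdash^{\alpha(\gamma)}_\rho\Gamma\cup\{\psi_\gamma\}$; ($\bigvee$) some $\psi\simeq\bigvee_{\gamma\prec\delta}\psi_\gamma$ in $\Gamma$, some $\gamma\prec\delta$ with $\gamma\prec\alpha$ and $\gamma\in\mathcal H(\emptyset)$, and $\alpha'\prec\alpha$ with $\mathcal H\vdash^{\alpha'}_\rho\Gamma\cup\{\psi_\gamma\}$; (Cut) some sentence $\psi$ with $\operatorname{rk}(\psi)\prec\rho$ and $\alpha'\prec\alpha$ with $\mathcal H\vdash^{\alpha'}_\rho\Gamma\cup\{\psi\}$ and $\mathcal H\vdash^{\alpha'}_\rho\Gamma\cup\{\neg\psi\}$;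 (Fix) $\Omega\preceq\alpha$, some $I^{\prec\Omega}_\varphi t\in\Gamma$ and $\alpha'\prec\alpha$ with $\mathcal H\vdash^{\alpha'}_\rho\Gamma\cup\{\varphi(t,I^{\prec\Omega}_\varphi)\}$. A single sentence is identified with the one-element sequent. -}

module Defs where

open import Data.Nat using (ℕ; zero; suc; _+_; _*_; _≡ᵇ_)
open import Data.Fin using (Fin; zero; suc)
open import Data.List using (List; []; _∷_; _++_; replicate; length; [_])
open import Data.List.Relation.Unary.All using (All)
open import Data.List.Relation.Unary.Any using (Any)
open import Data.List.Membership.Propositional using (_∈_)
open import Data.Bool using (Bool; true; false; if_then_else_)
open import Data.Unit using (⊤; tt)
open import Data.Empty using (⊥)
open import Data.Sum using (_⊎_)
open import Data.Product using (Σ; _×_; _,_)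
open import Relation.Binary.PropositionalEquality using (_≡_)

-- Ordinal terms ϑ(ε_{Ω+1}).
-- Raw terms; the terms of the paper are the raw terms satisfying WF.

data Tm : Set where
  Ω   : Tm
  ϑ   : Tm → Tm
  ⟨_⟩ : List Tm → Tm

mutual
  E : Tm → List Tm
  E Ω       = []
  E (ϑ a)   = ϑ a ∷ []
  E ⟨ as ⟩  = Es as

  Es : List Tm → List Tm
  Es []       = []
  Es (a ∷ as) = E a ++ Es as

infix 4 _≺_ _⪯_

mutual
  _⪯_ : Tm → Tm → Set
  a ⪯ b = (a ≺ b) ⊎ (a ≡ b)

  data _≺_ : Tm → Tm → Set where
    Ω≺⟨⟩    : ∀ {b bs} → Ω ⪯ b → Ω ≺ ⟨ b ∷ bs ⟩
    ϑ≺Ω     : ∀ {a} → ϑ a ≺ Ω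
    ϑ≺⟨⟩    : ∀ {a b bs} → ϑ a ⪯ b → ϑ a ≺ ⟨ b ∷ bs ⟩
    ϑ≺ϑ₁    : ∀ {a b} → a ≺ b → All (λ g → g ≺ ϑ b) (E a) → ϑ a ≺ ϑ b
    ϑ≺ϑ₂    : ∀ {a b} → Any (λ g → ϑ a ⪯ g) (E b) → ϑ a ≺ ϑ b
    ⟨⟩≺Ω    : ⟨ [] ⟩ ≺ Ω
    ⟨∷⟩≺Ω   : ∀ {a as} → a ≺ Ω → ⟨ a ∷ as ⟩ ≺ Ω
    ⟨⟩≺ϑ    : ∀ {b} → ⟨ [] ⟩ ≺ ϑ b
    ⟨∷⟩≺ϑ   : ∀ {a as b} → a ≺ ϑ b → ⟨ a ∷ as ⟩ ≺ ϑ b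
    ⟨⟩≺⟨⟩   : ∀ {as bs} → Lex as bs → ⟨ as ⟩ ≺ ⟨ bs ⟩

  data Lex : List Tm → List Tm → Set where
    prefix : ∀ {b bs} → Lex [] (b ∷ bs)
    here   : ∀ {a as b bs} → a ≺ b → Lex (a ∷ as) (b ∷ bs)
    there  : ∀ {a as bs} → Lex as bs → Lex (a ∷ as) (a ∷ bs)

data Desc : List Tm → Set where
  []  : Desc []
  [-] : ∀ {a} → Desc (a ∷ [])
  _∷_ : ∀ {a b bs} → b ⪯ a → Desc (b ∷ bs) → Desc (a ∷ b ∷ bs)

NotPrincipalSingleton : List Tm → Set
NotPrincipalSingleton (Ω ∷ [])   = ⊥
NotPrincipalSingleton (ϑ _ ∷ []) = ⊥
NotPrincipalSingleton _          = ⊤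

data WF : Tm → Set where
  Ω   : WF Ω
  ϑ   : ∀ {a} → WF a → WF (ϑ a)
  ⟨_⟩ : ∀ {as} → All WF as → Desc as → NotPrincipalSingleton as → WF ⟨ as ⟩

nat : ℕ → Tm
nat n = ⟨ replicate n ⟨ [] ⟩ ⟩

ω : Tm
ω = ⟨ nat 1 ∷ [] ⟩

-- the number denoted by a numeral term (junk 0 on non-numerals)
toℕ : Tm → ℕ
toℕ ⟨ l ⟩ = length l
toℕ _     = 0

-- α + 1, computed by the paper's addition (every term α_i satisfies 0 ⪯ α_i)
suc' : Tm → Tm
suc' Ω       = ⟨ Ω ∷ nat 0 ∷ [] ⟩
suc' (ϑ a)   = ⟨ ϑ a ∷ nat 0 ∷ [] ⟩
suc' ⟨ as ⟩  = ⟨ as ++ (nat 0 ∷ []) ⟩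

-- 1 + α, computed by the paper's addition (with ⟨Ω⟩, ⟨ϑβ⟩ read back as Ω, ϑβ)
onePlus : Tm → Tm
onePlus Ω                   = Ω
onePlus (ϑ a)               = ϑ a
onePlus ⟨ [] ⟩              = nat 1
onePlus ⟨ ⟨ [] ⟩ ∷ bs ⟩     = ⟨ ⟨ [] ⟩ ∷ ⟨ [] ⟩ ∷ bs ⟩
onePlus ⟨ Ω ∷ [] ⟩          = Ω
onePlus ⟨ ϑ b ∷ [] ⟩        = ϑ b
onePlus ⟨ b ∷ bs ⟩          = ⟨ b ∷ bs ⟩

ω· : Tm → Tm
ω· Ω              = Ω
ω· (ϑ a)          = ϑ a
ω· ⟨ [] ⟩         = ⟨ [] ⟩
ω· ⟨ a ∷ as ⟩     = ⟨ onePlus a ∷ as ⟩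

Ω·2+ : ℕ → Tm
Ω·2+ n = ⟨ Ω ∷ Ω ∷ replicate n ⟨ [] ⟩ ⟩

IsMax : Tm → Tm → Tm → Set
IsMax a b m = ((a ⪯ b) × (m ≡ b)) ⊎ ((b ≺ a) × (m ≡ a))

data PTm (n : ℕ) : Set where
  var  : Fin n → PTm n
  `0   : PTm n
  `S   : PTm n → PTm n
  _`+_ : PTm n → PTm n → PTm n
  _`*_ : PTm n → PTm n → PTm n

⟦_⟧ : PTm 0 → ℕ
⟦ var () ⟧
⟦ `0 ⟧      = 0
⟦ `S t ⟧    = suc ⟦ t ⟧
⟦ s `+ t ⟧  = ⟦ s ⟧ + ⟦ t ⟧
⟦ s `* t ⟧  = ⟦ s ⟧ * ⟦ t ⟧

numeral : ℕ → PTm 0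
numeral zero    = `0
numeral (suc n) = `S (numeral n)

data Fm (P N : Set) (n : ℕ) : Set where
  _≐_  : PTm n → PTm n → Fm P N n
  _≠_  : PTm n → PTm n → Fm P N n
  pos  : P → PTm n → Fm P N n
  neg  : N → PTm n → Fm P N n
  _∨_  : Fm P N n → Fm P N n → Fm P N n
  _∧_  : Fm P N n → Fm P N n → Fm P N n
  ∃'   : Fm P N (suc n) → Fm P N n
  ∀'   : Fm P N (suc n) → Fm P N n

-- operator forms φ(x,X): arithmetic formulas with X, one free variable,
-- no subformula ¬Xt (negated X-atoms are ruled out by N = ⊥)
OpForm : Set
OpForm = Fm ⊤ ⊥ 1

-- L_ID formulas with n free variables: atoms I_φ t
FmID : ℕ → Set
FmID = Fm OpForm OpForm

-- L^Ω_ID: atoms I^{≺α}_φ t, represented by the pair (φ , α)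
AtΩ : Set
AtΩ = OpForm × Tm

FmΩ : ℕ → Set
FmΩ = Fm AtΩ AtΩ

SentΩ : Set
SentΩ = FmΩ 0

renT : ∀ {m k} → (Fin m → Fin k) → PTm m → PTm k
renT r (var i)   = var (r i)
renT r `0        = `0
renT r (`S t)    = `S (renT r t)
renT r (s `+ t)  = renT r s `+ renT r t
renT r (s `* t)  = renT r s `* renT r t

subT : ∀ {m k} → (Fin m → PTm k) → PTm m → PTm k
subT σ (var i)   = σ i
subT σ `0        = `0
subT σ (`S t)    = `S (subT σ t)
subT σ (s `+ t)  = subT σ s `+ subT σ t
subT σ (s `* t)  = subT σ s `* subT σ t

lift : ∀ {m k} → (Fin m → PTm k) → Fin (suc m) → PTm (suc k)
lift σ zero    = var zero
lift σ (suc i) = renT suc (σ i)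

subF : ∀ {P N m k} → (Fin m → PTm k) → Fm P N m → Fm P N k
subF σ (s ≐ t)   = subT σ s ≐ subT σ t
subF σ (s ≠ t)   = subT σ s ≠ subT σ t
subF σ (pos p t) = pos p (subT σ t)
subF σ (neg p t) = neg p (subT σ t)
subF σ (a ∨ b)   = subF σ a ∨ subF σ b
subF σ (a ∧ b)   = subF σ a ∧ subF σ b
subF σ (∃' a)    = ∃' (subF (lift σ) a)
subF σ (∀' a)    = ∀' (subF (lift σ) a)

inst : ∀ {P N k} → Fm P N 1 → PTm k → Fm P N k
inst ψ t = subF (λ _ → t) ψ

substX : ∀ {A m k} → (Fin m → PTm k) → Fm ⊤ ⊥ m → Fm A A 1 → Fm A A k
substX σ (s ≐ t)    θ = subT σ s ≐ subT σ t
substX σ (s ≠ t)    θ = subT σ s ≠ subT σ t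
substX σ (pos _ s)  θ = inst θ (subT σ s)
substX σ (neg () s) θ
substX σ (a ∨ b)    θ = substX σ a θ ∨ substX σ b θ
substX σ (a ∧ b)    θ = substX σ a θ ∧ substX σ b θ
substX σ (∃' a)     θ = ∃' (substX (lift σ) a θ)
substX σ (∀' a)     θ = ∀' (substX (lift σ) a θ)

_⟪_,_⟫ : ∀ {A k} → Fm ⊤ ⊥ 1 → PTm k → Fm A A 1 → Fm A A k
φ ⟪ t , θ ⟫ = substX (λ _ → t) φ θ

I : OpForm → Tm → FmΩ 1
I φ γ = pos (φ , γ) (var zero)

¬ᶠ : ∀ {A n} → Fm A A n → Fm A A n
¬ᶠ (s ≐ t)   = s ≠ t
¬ᶠ (s ≠ t)   = s ≐ t
¬ᶠ (pos p t) = neg p t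
¬ᶠ (neg p t) = pos p t
¬ᶠ (a ∨ b)   = ¬ᶠ a ∧ ¬ᶠ b
¬ᶠ (a ∧ b)   = ¬ᶠ a ∨ ¬ᶠ b
¬ᶠ (∃' a)    = ∀' (¬ᶠ a)
¬ᶠ (∀' a)    = ∃' (¬ᶠ a)

_⇒_ : ∀ {A n} → Fm A A n → Fm A A n → Fm A A n
a ⇒ b = ¬ᶠ a ∨ b

plus : ∀ {n} → FmID n → FmΩ n
plus (s ≐ t)   = s ≐ t
plus (s ≠ t)   = s ≠ t
plus (pos φ t) = pos (φ , Ω) t
plus (neg φ t) = neg (φ , Ω) t
plus (a ∨ b)   = plus a ∨ plus b
plus (a ∧ b)   = plus a ∧ plus b
plus (∃' a)    = ∃' (plus a)
plus (∀' a)    = ∀' (plus a)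

-- Assignment of a disjunction ⋁_{γ≺δ} ψ_γ or conjunction ⋀_{γ≺δ} ψ_γ
-- to each sentence.  The family is given for all γ; only γ ≺ δ matter.

data Kind : Set where
  disj conj : Kind

record Junction : Set where
  constructor mkJ
  field
    kind  : Kind
    bound : Tm
    fam   : Tm → SentΩ

pick : Tm → SentΩ → SentΩ → SentΩ
pick ⟨ [] ⟩ a b = a
pick _      a b = b

junction : SentΩ → Junction
junction (s ≐ t)         = mkJ (if ⟦ s ⟧ ≡ᵇ ⟦ t ⟧ then conj else disj) (nat 0) (λ _ → s ≐ t)
junction (s ≠ t)         = mkJ (if ⟦ s ⟧ ≡ᵇ ⟦ t ⟧ then disj else conj) (nat 0) (λ _ → s ≠ t)
junction (pos (φ , α) t) = mkJ disj α (λ γ → φ ⟪ t , I φ γ ⟫)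
junction (neg (φ , α) t) = mkJ conj α (λ γ → ¬ᶠ (φ ⟪ t , I φ γ ⟫))
junction (a ∨ b)         = mkJ disj (nat 2) (λ γ → pick γ a b)
junction (a ∧ b)         = mkJ conj (nat 2) (λ γ → pick γ a b)
junction (∃' a)          = mkJ disj ω (λ γ → inst a (numeral (toℕ γ)))
junction (∀' a)          = mkJ conj ω (λ γ → inst a (numeral (toℕ γ)))

-- Ranks (as a relation, since max needs the order ≺)

data Rank {n : ℕ} : FmΩ n → Tm → Set where
  rk≐   : ∀ {s t} → Rank (s ≐ t) (nat 0)
  rk≠   : ∀ {s t} → Rank (s ≠ t) (nat 0)
  rkpos : ∀ {φ α t} → Rank (pos (φ , α) t) (ω· α)
  rkneg : ∀ {φ α t} → Rank (neg (φ , α) t) (ω· α)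
  rk∨   : ∀ {a b r s m} → Rank a r → Rank b s → IsMax r s m → Rank (a ∨ b) (suc' m)
  rk∧   : ∀ {a b r s m} → Rank a r → Rank b s → IsMax r s m → Rank (a ∧ b) (suc' m)
  rk∃   : ∀ {a r} → Rank {suc n} a r → Rank (∃' a) (suc' r)
  rk∀   : ∀ {a r} → Rank {suc n} a r → Rank (∀' a) (suc' r)

k : ∀ {n} → FmΩ n → List Tm
k (s ≐ t)         = []
k (s ≠ t)         = []
k (pos (φ , α) t) = α ∷ []
k (neg (φ , α) t) = α ∷ []
k (a ∨ b)         = k a ++ k b
k (a ∧ b)         = k a ++ k b
k (∃' a)          = k a
k (∀' a)          = k a

IsLΩ : SentΩ → Set
IsLΩ ψ = All (λ α → WF α × (α ⪯ Ω)) (k ψ)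

-- Operators on the powerset of terms.  Subsets are predicates on raw
-- terms; all conditions are relative to the well-formed terms.

Subset : Set₁
Subset = Tm → Set

Op : Set₁
Op = Subset → Subset

∅ : Subset
∅ _ = ⊥

_⊆_ : Subset → Subset → Set
X ⊆ Y = ∀ α → WF α → X α → Y α

record Nice (H : Op) : Set₁ where
  field
    inflationary : ∀ X → X ⊆ H X
    closure      : ∀ X Y → X ⊆ H Y → H X ⊆ H Y
    E-closed₁    : ∀ X α → WF α → H X α → All (H X) (E α)
    E-closed₂    : ∀ X α → WF α → All (H X) (E α) → H X α

-- H[Z](X) = H(Z ∪ X), here with Z = {γ}
_[_]ᴴ : Op → Tm → Op
(H [ γ ]ᴴ) X = H (λ β → (β ≡ γ) ⊎ X β)

Sequent : Set
Sequent = List SentΩ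

Admissible : Op → Tm → Sequent → Set
Admissible H α Γ = WF α × H ∅ α × All (λ ψ → All (H ∅) (k ψ)) Γ

data Der : Op → Tm → Tm → Sequent → Set₁ where
  ⋀-rule : ∀ {H α ρ Γ ψ} → Admissible H α Γ → ψ ∈ Γ →
           Junction.kind (junction ψ) ≡ conj →
           (∀ γ → WF γ → γ ≺ Junction.bound (junction ψ) →
              Σ Tm λ β → WF β × (β ≺ α) ×
                Der (H [ γ ]ᴴ) β ρ (Junction.fam (junction ψ) γ ∷ Γ)) →
           Der H α ρ Γ
  ⋁-rule : ∀ {H α ρ Γ ψ} → Admissible H α Γ → ψ ∈ Γ →
           Junction.kind (junction ψ) ≡ disj →
           ∀ γ → WF γ → γ ≺ Junction.bound (junction ψ) → γ ≺ α → H ∅ γ →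
           ∀ α' → WF α' → α' ≺ α →
           Der H α' ρ (Junction.fam (junction ψ) γ ∷ Γ) →
           Der H α ρ Γ
  cut    : ∀ {H α ρ Γ} → Admissible H α Γ →
           ∀ ψ → IsLΩ ψ → ∀ r → Rank ψ r → r ≺ ρ →
           ∀ α' → WF α' → α' ≺ α →
           Der H α' ρ (ψ ∷ Γ) → Der H α' ρ (¬ᶠ ψ ∷ Γ) →
           Der H α ρ Γ
  fix    : ∀ {H α ρ Γ} → Admissible H α Γ → Ω ⪯ α →
           ∀ φ t → pos (φ , Ω) t ∈ Γ →
           ∀ α' → WF α' → α' ≺ α →
           Der H α' ρ (φ ⟪ t , I φ Ω ⟫ ∷ Γ) →
           Der H α ρ Γ

IndSentence : OpForm → FmID 1 → SentΩ
IndSentence φ ψ =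
  ∀' ((φ ⟪ var zero , plus ψ ⟫) ⇒ plus ψ) ⇒ ∀' (I φ Ω ⇒ plus ψ)

-- Write A for ∀x(φ(x,ψ⁺) → ψ⁺(x)).  Unfolding the induction sentence by ⋁ and ⋀ inferences reduces it
-- to the sequents ¬A, ¬φ(m, I^{≺δ}), ψ⁺(m) with δ ≺ Ω.  By induction on δ (≺ is well founded below Ω,
-- by Buchholz's argument) one derives ¬A, ¬I^{≺δ}r, ψ⁺(r): each ⋀-premise ¬φ(r, I^{≺ε}), ε ≺ δ, is
-- closed by instantiating ¬A at r and matching φ(r, ψ⁺) against φ(r, I^{≺ε}), and ψ⁺(r) against itself,
-- by generalised identities; their leaves are closed by the induction hypothesis at ε and by the
-- identity for I^{≺Ω}-literals.  Heights Ω + ω^c + n, with c = ω^δ + 1 decreasing along δ, keep every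
-- derivation below Ω·2 + ω, and no cut is used.

module Submission where

open import Defs
open import Data.Nat using (ℕ; zero; suc; _+_; _*_; _≤_; s≤s; _≡ᵇ_)
open import Data.Nat.Properties using (m≤m+n; m≤n+m; ≤-refl; m+n≤o⇒m≤o; m+n≤o⇒n≤o)
open import Data.Fin using (Fin; zero; suc)
open import Data.Bool using (true; false)
open import Data.List using (List; []; _∷_; _++_; replicate; [_])
open import Data.List.Properties using (length-replicate)
import Data.List.Relation.Unary.All as All
open import Data.List.Relation.Unary.All using (All; []; _∷_; lookup; lookupAny; zip) renaming (map to mapAll)
open import Data.List.Relation.Unary.All.Properties using (++⁺; ++⁻; replicate⁺)
open import Data.List.Relation.Unary.Any using (here; there)
open import Data.List.Membership.Propositional using (_∈_)
open import Data.List.Relation.Binary.Subset.Propositional using () renaming (_⊆_ to _⊆ˢ_)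
open import Function using (id)
open import Data.Unit using (⊤; tt)
open import Data.Empty using (⊥; ⊥-elim)
open import Data.Sum using (_⊎_; inj₁; inj₂; [_,_]′)
open import Data.Product using (Σ; _×_; _,_; proj₁; proj₂)
open import Induction.WellFounded using (Acc; acc; WfRec)
open import Relation.Nullary using (¬_)
open import Relation.Binary.PropositionalEquality using (_≡_; refl; sym; trans; cong; cong₂; subst; subst₂)

≮0 : ∀ {a} → ¬ (a ≺ nat 0)
≮0 (⟨⟩≺⟨⟩ ())

0⪯ : ∀ a → nat 0 ⪯ a
0⪯ Ω          = inj₁ ⟨⟩≺Ω
0⪯ (ϑ a)      = inj₁ ⟨⟩≺ϑ
0⪯ ⟨ [] ⟩     = inj₂ refl
0⪯ ⟨ _ ∷ _ ⟩  = inj₁ (⟨⟩≺⟨⟩ prefix)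

Ω⪯⇒≮Ω : ∀ {a} → Ω ⪯ a → ¬ (a ≺ Ω)
Ω⪯⇒≮Ω (inj₂ refl)          ()
Ω⪯⇒≮Ω (inj₁ (Ω≺⟨⟩ Ω⪯b)) (⟨∷⟩≺Ω b≺Ω) = Ω⪯⇒≮Ω Ω⪯b b≺Ω

≺-trans-Ω : ∀ {a b} → a ≺ b → b ≺ Ω → a ≺ Ω
≺-trans-Ω (Ω≺⟨⟩ Ω⪯c)         (⟨∷⟩≺Ω c≺Ω) = ⊥-elim (Ω⪯⇒≮Ω Ω⪯c c≺Ω)
≺-trans-Ω (ϑ≺⟨⟩ _)           _           = ϑ≺Ω
≺-trans-Ω (ϑ≺ϑ₁ _ _)         _           = ϑ≺Ω
≺-trans-Ω (ϑ≺ϑ₂ _)           _           = ϑ≺Ω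
≺-trans-Ω ⟨⟩≺ϑ               _           = ⟨⟩≺Ω
≺-trans-Ω (⟨∷⟩≺ϑ a≺b)        b≺Ω         = ⟨∷⟩≺Ω (≺-trans-Ω a≺b b≺Ω)
≺-trans-Ω (⟨⟩≺⟨⟩ prefix)     _           = ⟨⟩≺Ω
≺-trans-Ω (⟨⟩≺⟨⟩ (here a≺b)) (⟨∷⟩≺Ω b≺Ω) = ⟨∷⟩≺Ω (≺-trans-Ω a≺b b≺Ω)
≺-trans-Ω (⟨⟩≺⟨⟩ (there _))  (⟨∷⟩≺Ω b≺Ω) = ⟨∷⟩≺Ω b≺Ω

⪯-trans-Ω : ∀ {a b} → a ⪯ b → b ≺ Ω → a ≺ Ω
⪯-trans-Ω (inj₁ a≺b)  = ≺-trans-Ω a≺b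
⪯-trans-Ω (inj₂ refl) = λ b≺Ω → b≺Ω

≺-trans-⪯Ω : ∀ {a b} → a ≺ b → b ⪯ Ω → a ≺ Ω
≺-trans-⪯Ω a≺b (inj₁ b≺Ω) = ≺-trans-Ω a≺b b≺Ω
≺-trans-⪯Ω a≺Ω (inj₂ refl) = a≺Ω

head≺⟨∷⟩ : ∀ b bs → b ≺ ⟨ b ∷ bs ⟩
head≺⟨∷⟩ Ω          _ = Ω≺⟨⟩ (inj₂ refl)
head≺⟨∷⟩ (ϑ _)      _ = ϑ≺⟨⟩ (inj₂ refl)
head≺⟨∷⟩ ⟨ [] ⟩     _ = ⟨⟩≺⟨⟩ prefix
head≺⟨∷⟩ ⟨ c ∷ cs ⟩ _ = ⟨⟩≺⟨⟩ (here (head≺⟨∷⟩ c cs))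

≺head⇒≺⟨∷⟩ : ∀ {a b} bs → a ≺ b → a ≺ ⟨ b ∷ bs ⟩
≺head⇒≺⟨∷⟩ {Ω}          _ a≺b                  = Ω≺⟨⟩ (inj₁ a≺b)
≺head⇒≺⟨∷⟩ {ϑ _}        _ a≺b                  = ϑ≺⟨⟩ (inj₁ a≺b)
≺head⇒≺⟨∷⟩ {⟨ [] ⟩}     _ _                    = ⟨⟩≺⟨⟩ prefix
≺head⇒≺⟨∷⟩ {⟨ _ ∷ _ ⟩}  _ (⟨∷⟩≺Ω c≺b)          = ⟨⟩≺⟨⟩ (here c≺b)
≺head⇒≺⟨∷⟩ {⟨ _ ∷ _ ⟩}  _ (⟨∷⟩≺ϑ c≺b)          = ⟨⟩≺⟨⟩ (here c≺b)
≺head⇒≺⟨∷⟩ {⟨ _ ∷ _ ⟩}  _ (⟨⟩≺⟨⟩ (here c≺d))   = ⟨⟩≺⟨⟩ (here (≺head⇒≺⟨∷⟩ _ c≺d))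
≺head⇒≺⟨∷⟩ {⟨ c ∷ _ ⟩}  _ (⟨⟩≺⟨⟩ (there _))    = ⟨⟩≺⟨⟩ (here (head≺⟨∷⟩ c _))

-- Well-foundedness of ≺ below Ω

≺-within : (Tm → Set) → Tm → Tm → Set
≺-within P b a = P b × b ≺ a

module Lex-Acc (P : Tm → Set) (P-⟨⟩ : ∀ {l} → P ⟨ l ⟩ → Desc l × All P l) where

  private
    _⊏_ : Tm → Tm → Set
    _⊏_ = ≺-within P

  DescP : List Tm → Set
  DescP l = Desc l × All P l

  _<ₗ_ : List Tm → List Tm → Set
  x <ₗ y = DescP x × Lex x y

  _⪯-head_ : List Tm → Tm → Set
  []      ⪯-head a = ⊤
  (b ∷ _) ⪯-head a = b ⪯ a

  HeadAcc : List Tm → Set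
  HeadAcc []      = ⊤
  HeadAcc (b ∷ _) = Acc _⊏_ b

  private
    head : ∀ {b t} → DescP (b ∷ t) → P b
    head (_ , pb ∷ _) = pb

    tail : ∀ {b t} → DescP (b ∷ t) → DescP t
    tail (Desc.[-] , _ ∷ pt)   = Desc.[] , pt
    tail (_ Desc.∷ d , _ ∷ pt) = d , pt

    tail-⪯-head : ∀ {b t} → DescP (b ∷ t) → t ⪯-head b
    tail-⪯-head {t = []}    _                = tt
    tail-⪯-head {t = _ ∷ _} (c⪯b Desc.∷ _ , _) = c⪯b

  acc-[] : Acc _<ₗ_ []
  acc-[] = acc λ { (_ , ()) }

  acc-⪯ : ∀ {y a} → P y → y ⪯ a → Acc _⊏_ a → Acc _⊏_ y
  acc-⪯ py (inj₁ y≺a) (acc rs) = rs (py , y≺a)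
  acc-⪯ _  (inj₂ refl) acc-a   = acc-a

  mutual
    acc-∷ : ∀ {a t} → Acc _⊏_ a → Acc _<ₗ_ t → Acc _<ₗ_ (a ∷ t)
    acc-∷ acc-a acc-t = acc (acc-∷-below acc-a acc-t)

    acc-∷-below : ∀ {a t} → Acc _⊏_ a → Acc _<ₗ_ t → WfRec _<ₗ_ (Acc _<ₗ_) (a ∷ t)
    acc-∷-below _        _        {[]}    (_ , prefix)     = acc-[]
    acc-∷-below (acc rs) _        {_ ∷ _} (dy , here c≺a)  = acc-desc (rs (head dy , c≺a)) dy (inj₂ refl)
    acc-∷-below acc-a    (acc rt) {_ ∷ _} (dy , there x<t) = acc-∷ acc-a (rt (tail dy , x<t))

    acc-desc : ∀ {a l} → Acc _⊏_ a → DescP l → l ⪯-head a → Acc _<ₗ_ l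
    acc-desc {l = []}    _        _  _           = acc-[]
    acc-desc {l = _ ∷ _} (acc rs) dl (inj₁ b≺a)  = acc-desc (rs (head dl , b≺a)) dl (inj₂ refl)
    acc-desc {l = _ ∷ _} acc-a    dl (inj₂ refl) = acc-∷ acc-a (acc-desc acc-a (tail dl) (tail-⪯-head dl))

  private
    HeadAcc-lex : ∀ {x l} → DescP x → Lex x l → HeadAcc l → HeadAcc x
    HeadAcc-lex {[]}    _            _          _        = tt
    HeadAcc-lex {_ ∷ _} (_ , pc ∷ _) (here c≺b) (acc rs) = rs (pc , c≺b)
    HeadAcc-lex {_ ∷ _} _            (there _)  acc-b    = acc-b

    acc-⟨⟩-lex : ∀ {l} → Acc _<ₗ_ l → HeadAcc l → Acc _⊏_ ⟨ l ⟩
    acc-⟨⟩-lex (acc rl) acc-head = acc λ where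
      (pΩ , Ω≺⟨⟩ Ω⪯b) → acc-⪯ pΩ Ω⪯b acc-head
      (pϑ , ϑ≺⟨⟩ ϑ⪯b) → acc-⪯ pϑ ϑ⪯b acc-head
      (px , ⟨⟩≺⟨⟩ x<l) → let dx = P-⟨⟩ px in acc-⟨⟩-lex (rl (dx , x<l)) (HeadAcc-lex dx x<l acc-head)

  acc-⟨⟩ : ∀ {l} → DescP l → HeadAcc l → Acc _⊏_ ⟨ l ⟩
  acc-⟨⟩ {[]}    _  _     = acc-⟨⟩-lex acc-[] tt
  acc-⟨⟩ {_ ∷ _} dl acc-a = acc-⟨⟩-lex (acc-desc acc-a dl (inj₂ refl)) acc-a

acc-0 : ∀ {P} → Acc (≺-within P) (nat 0)
acc-0 = acc λ { (_ , a≺0) → ⊥-elim (≮0 a≺0) }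

BelowΩ : Tm → Set
BelowΩ a = WF a × a ≺ Ω

Accessible : Tm → Set
Accessible = Acc (≺-within BelowΩ)

E-Accessible : Tm → Set
E-Accessible α = All Accessible (E α)

-- The terms α over which ϑα is shown accessible, by induction along ≺ (Buchholz's argument).
Good : Tm → Set
Good α = WF α × E-Accessible α

desc-≺Ω : ∀ {b l} → b ≺ Ω → Desc (b ∷ l) → All (_≺ Ω) (b ∷ l)
desc-≺Ω {l = []}    b≺Ω _                = b≺Ω ∷ []
desc-≺Ω {l = _ ∷ _} b≺Ω (c⪯b Desc.∷ dl) = b≺Ω ∷ desc-≺Ω (⪯-trans-Ω c⪯b b≺Ω) dl

BelowΩ-⟨⟩ : ∀ {l} → BelowΩ ⟨ l ⟩ → Desc l × All BelowΩ l
BelowΩ-⟨⟩ {[]}    _                          = Desc.[] , []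
BelowΩ-⟨⟩ {_ ∷ _} (⟨ wl ⟩ dl _ , ⟨∷⟩≺Ω b≺Ω) = dl , zip (wl , desc-≺Ω b≺Ω dl)

Es-Accessible : ∀ l → All Accessible (Es l) → All E-Accessible l
Es-Accessible []      _  = []
Es-Accessible (a ∷ l) ea = let ea₁ , ea₂ = ++⁻ (E a) ea in ea₁ ∷ Es-Accessible l ea₂

Good-⟨⟩ : ∀ {l} → Good ⟨ l ⟩ → Desc l × All Good l
Good-⟨⟩ {l} (⟨ wl ⟩ dl _ , ea) = dl , zip (wl , Es-Accessible l ea)

module AccΩ = Lex-Acc BelowΩ BelowΩ-⟨⟩
module AccGood = Lex-Acc Good Good-⟨⟩

module ϑ-Step {α} (ea : E-Accessible α) (ih : ∀ {β} → Good β → β ≺ α → Accessible (ϑ β)) where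
  mutual
    accessible-below : ∀ γ → BelowΩ γ → γ ≺ ϑ α → Accessible γ
    accessible-below ⟨ [] ⟩    _   _                 = acc-0
    accessible-below ⟨ a ∷ l ⟩ bγ (⟨∷⟩≺ϑ a≺ϑα)       =
      let dγ = BelowΩ-⟨⟩ bγ in AccΩ.acc-⟨⟩ dγ (accessible-below a (All.head (proj₂ dγ)) a≺ϑα)
    accessible-below (ϑ β)     (ϑ wβ , _) (ϑ≺ϑ₁ β≺α E≺ϑα) = ih (wβ , E-accessible-below β wβ E≺ϑα) β≺α
    accessible-below (ϑ β)     bγ (ϑ≺ϑ₂ ϑβ⪯E) =
      let acc-g , ϑβ⪯g = lookupAny ea ϑβ⪯E in AccΩ.acc-⪯ bγ ϑβ⪯g acc-g

    E-accessible-below : ∀ β → WF β → All (_≺ ϑ α) (E β) → E-Accessible β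
    E-accessible-below Ω      _           _          = []
    E-accessible-below (ϑ c)  w           (p ∷ [])   = accessible-below (ϑ c) (w , ϑ≺Ω) p ∷ []
    E-accessible-below ⟨ l ⟩  (⟨ wl ⟩ _ _) ps       = Es-accessible-below l wl ps

    Es-accessible-below : ∀ l → All WF l → All (_≺ ϑ α) (Es l) → All Accessible (Es l)
    Es-accessible-below []      _        _  = []
    Es-accessible-below (a ∷ l) (w ∷ wl) ps =
      let ps₁ , ps₂ = ++⁻ (E a) ps in
      ++⁺ (E-accessible-below a w ps₁) (Es-accessible-below l wl ps₂)

accessible-ϑ : ∀ {α} → Acc (≺-within Good) α → Good α → Accessible (ϑ α)
accessible-ϑ (acc rs) (_ , ea) = acc λ { {γ} (bγ , γ≺ϑα) →
  ϑ-Step.accessible-below ea (λ gβ β≺α → accessible-ϑ (rs (gβ , β≺α)) gβ) γ bγ γ≺ϑα }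

accessible⇒acc-Good : ∀ {y} → Accessible y → y ≺ Ω → Acc (≺-within Good) y
accessible⇒acc-Good (acc rs) y≺Ω = acc λ { ((wc , _) , c≺y) →
  let c≺Ω = ≺-trans-Ω c≺y y≺Ω in accessible⇒acc-Good (rs ((wc , c≺Ω) , c≺y)) c≺Ω }

Good⇒accessible : ∀ y → Good y → y ≺ Ω → Accessible y
Good⇒accessible (ϑ _)     (_ , acc-ϑ ∷ []) _  = acc-ϑ
Good⇒accessible ⟨ [] ⟩    _               _  = acc-0
Good⇒accessible ⟨ a ∷ l ⟩ gy@(w , _) y≺Ω@(⟨∷⟩≺Ω a≺Ω) =
  AccΩ.acc-⟨⟩ (BelowΩ-⟨⟩ (w , y≺Ω)) (Good⇒accessible a (All.head (proj₂ (Good-⟨⟩ gy))) a≺Ω)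

Good-acc : ∀ α → Good α → Acc (≺-within Good) α
Good-acc Ω         _                = acc λ { {y} (gy , y≺Ω) → accessible⇒acc-Good (Good⇒accessible y gy y≺Ω) y≺Ω }
Good-acc (ϑ _)     (_ , acc-ϑ ∷ []) = accessible⇒acc-Good acc-ϑ ϑ≺Ω
Good-acc ⟨ [] ⟩    _                = acc-0
Good-acc ⟨ a ∷ l ⟩ gα = let dα = Good-⟨⟩ gα in AccGood.acc-⟨⟩ dα (Good-acc a (All.head (proj₂ dα)))

mutual
  BelowΩ⇒accessible : ∀ δ → BelowΩ δ → Accessible δ
  BelowΩ⇒accessible (ϑ α)     (ϑ w , _) = accessible-ϑ (Good-acc α gα) gα
    where gα = w , WF⇒E-accessible α w
  BelowΩ⇒accessible ⟨ [] ⟩    _          = acc-0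
  BelowΩ⇒accessible ⟨ a ∷ l ⟩ bδ =
    let dδ = BelowΩ-⟨⟩ bδ in AccΩ.acc-⟨⟩ dδ (BelowΩ⇒accessible a (All.head (proj₂ dδ)))

  WF⇒E-accessible : ∀ α → WF α → E-Accessible α
  WF⇒E-accessible Ω      _            = []
  WF⇒E-accessible (ϑ c)  w            = BelowΩ⇒accessible (ϑ c) (w , ϑ≺Ω) ∷ []
  WF⇒E-accessible ⟨ l ⟩  (⟨ wl ⟩ _ _) = WF⇒Es-accessible l wl

  WF⇒Es-accessible : ∀ l → All WF l → All Accessible (Es l)
  WF⇒Es-accessible []      _        = []
  WF⇒Es-accessible (a ∷ l) (w ∷ wl) = ++⁺ (WF⇒E-accessible a w) (WF⇒Es-accessible l wl)

Ω-accessible : Accessible Ω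
Ω-accessible = acc λ { {δ} (bδ , _) → BelowΩ⇒accessible δ bδ }

-- Substitution

subT-cong : ∀ {m k} {σ σ′ : Fin m → PTm k} → (∀ i → σ i ≡ σ′ i) → ∀ t → subT σ t ≡ subT σ′ t
subT-cong e (var i)  = e i
subT-cong e `0       = refl
subT-cong e (`S t)   = cong `S (subT-cong e t)
subT-cong e (s `+ t) = cong₂ _`+_ (subT-cong e s) (subT-cong e t)
subT-cong e (s `* t) = cong₂ _`*_ (subT-cong e s) (subT-cong e t)

lift-cong : ∀ {m k} {σ σ′ : Fin m → PTm k} → (∀ i → σ i ≡ σ′ i) → ∀ i → lift σ i ≡ lift σ′ i
lift-cong e zero    = refl
lift-cong e (suc i) = cong (renT suc) (e i)

subF-cong : ∀ {P N m k} {σ σ′ : Fin m → PTm k} → (∀ i → σ i ≡ σ′ i) → (a : Fm P N m) → subF σ a ≡ subF σ′ a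
subF-cong e (s ≐ t)   = cong₂ _≐_ (subT-cong e s) (subT-cong e t)
subF-cong e (s ≠ t)   = cong₂ _≠_ (subT-cong e s) (subT-cong e t)
subF-cong e (pos p t) = cong (pos p) (subT-cong e t)
subF-cong e (neg p t) = cong (neg p) (subT-cong e t)
subF-cong e (a ∨ b)   = cong₂ _∨_ (subF-cong e a) (subF-cong e b)
subF-cong e (a ∧ b)   = cong₂ _∧_ (subF-cong e a) (subF-cong e b)
subF-cong e (∃' a)    = cong ∃' (subF-cong (lift-cong e) a)
subF-cong e (∀' a)    = cong ∀' (subF-cong (lift-cong e) a)

substX-cong : ∀ {A m k} {σ σ′ : Fin m → PTm k} → (∀ i → σ i ≡ σ′ i) →
  (a : Fm ⊤ ⊥ m) (θ : Fm A A 1) → substX σ a θ ≡ substX σ′ a θ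
substX-cong e (s ≐ t)    θ = cong₂ _≐_ (subT-cong e s) (subT-cong e t)
substX-cong e (s ≠ t)    θ = cong₂ _≠_ (subT-cong e s) (subT-cong e t)
substX-cong e (pos _ s)  θ = cong (inst θ) (subT-cong e s)
substX-cong e (a ∨ b)    θ = cong₂ _∨_ (substX-cong e a θ) (substX-cong e b θ)
substX-cong e (a ∧ b)    θ = cong₂ _∧_ (substX-cong e a θ) (substX-cong e b θ)
substX-cong e (∃' a)     θ = cong ∃' (substX-cong (lift-cong e) a θ)
substX-cong e (∀' a)     θ = cong ∀' (substX-cong (lift-cong e) a θ)

subT-subT : ∀ {m k l} (τ : Fin k → PTm l) (σ : Fin m → PTm k) t →
  subT τ (subT σ t) ≡ subT (λ i → subT τ (σ i)) t
subT-subT τ σ (var i)  = refl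
subT-subT τ σ `0       = refl
subT-subT τ σ (`S t)   = cong `S (subT-subT τ σ t)
subT-subT τ σ (s `+ t) = cong₂ _`+_ (subT-subT τ σ s) (subT-subT τ σ t)
subT-subT τ σ (s `* t) = cong₂ _`*_ (subT-subT τ σ s) (subT-subT τ σ t)

subT-renT : ∀ {m k l} (τ : Fin k → PTm l) (r : Fin m → Fin k) t → subT τ (renT r t) ≡ subT (λ i → τ (r i)) t
subT-renT τ r (var i)  = refl
subT-renT τ r `0       = refl
subT-renT τ r (`S t)   = cong `S (subT-renT τ r t)
subT-renT τ r (s `+ t) = cong₂ _`+_ (subT-renT τ r s) (subT-renT τ r t)
subT-renT τ r (s `* t) = cong₂ _`*_ (subT-renT τ r s) (subT-renT τ r t)

renT-subT : ∀ {m k l} (r : Fin k → Fin l) (τ : Fin m → PTm k) t → renT r (subT τ t) ≡ subT (λ i → renT r (τ i)) t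
renT-subT r τ (var i)  = refl
renT-subT r τ `0       = refl
renT-subT r τ (`S t)   = cong `S (renT-subT r τ t)
renT-subT r τ (s `+ t) = cong₂ _`+_ (renT-subT r τ s) (renT-subT r τ t)
renT-subT r τ (s `* t) = cong₂ _`*_ (renT-subT r τ s) (renT-subT r τ t)

subT-lift : ∀ {m k l} (τ : Fin k → PTm l) (σ : Fin m → PTm k) i →
  subT (lift τ) (lift σ i) ≡ lift (λ j → subT τ (σ j)) i
subT-lift τ σ zero    = refl
subT-lift τ σ (suc i) = trans (subT-renT (lift τ) suc (σ i)) (sym (renT-subT suc τ (σ i)))

subF-subF : ∀ {P N m k l} (τ : Fin k → PTm l) (σ : Fin m → PTm k) (a : Fm P N m) →
  subF τ (subF σ a) ≡ subF (λ i → subT τ (σ i)) a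
subF-subF τ σ (s ≐ t)   = cong₂ _≐_ (subT-subT τ σ s) (subT-subT τ σ t)
subF-subF τ σ (s ≠ t)   = cong₂ _≠_ (subT-subT τ σ s) (subT-subT τ σ t)
subF-subF τ σ (pos p t) = cong (pos p) (subT-subT τ σ t)
subF-subF τ σ (neg p t) = cong (neg p) (subT-subT τ σ t)
subF-subF τ σ (a ∨ b)   = cong₂ _∨_ (subF-subF τ σ a) (subF-subF τ σ b)
subF-subF τ σ (a ∧ b)   = cong₂ _∧_ (subF-subF τ σ a) (subF-subF τ σ b)
subF-subF τ σ (∃' a)    = cong ∃' (trans (subF-subF (lift τ) (lift σ) a) (subF-cong (subT-lift τ σ) a))
subF-subF τ σ (∀' a)    = cong ∀' (trans (subF-subF (lift τ) (lift σ) a) (subF-cong (subT-lift τ σ) a))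

subF-substX : ∀ {A m k l} (τ : Fin k → PTm l) (σ : Fin m → PTm k) (a : Fm ⊤ ⊥ m) (θ : Fm A A 1) →
  subF τ (substX σ a θ) ≡ substX (λ i → subT τ (σ i)) a θ
subF-substX τ σ (s ≐ t)   θ = cong₂ _≐_ (subT-subT τ σ s) (subT-subT τ σ t)
subF-substX τ σ (s ≠ t)   θ = cong₂ _≠_ (subT-subT τ σ s) (subT-subT τ σ t)
subF-substX τ σ (pos _ s) θ = trans (subF-subF τ (λ _ → subT σ s) θ) (subF-cong (λ _ → subT-subT τ σ s) θ)
subF-substX τ σ (a ∨ b)   θ = cong₂ _∨_ (subF-substX τ σ a θ) (subF-substX τ σ b θ)
subF-substX τ σ (a ∧ b)   θ = cong₂ _∧_ (subF-substX τ σ a θ) (subF-substX τ σ b θ)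
subF-substX τ σ (∃' a)    θ =
  cong ∃' (trans (subF-substX (lift τ) (lift σ) a θ) (substX-cong (subT-lift τ σ) a θ))
subF-substX τ σ (∀' a)    θ =
  cong ∀' (trans (subF-substX (lift τ) (lift σ) a θ) (substX-cong (subT-lift τ σ) a θ))

subT-closed : ∀ (ρ : Fin 0 → PTm 0) u → subT ρ u ≡ u
subT-closed ρ (var ())
subT-closed ρ `0       = refl
subT-closed ρ (`S u)   = cong `S (subT-closed ρ u)
subT-closed ρ (s `+ t) = cong₂ _`+_ (subT-closed ρ s) (subT-closed ρ t)
subT-closed ρ (s `* t) = cong₂ _`*_ (subT-closed ρ s) (subT-closed ρ t)

extend : ∀ {m} → (Fin m → PTm 0) → PTm 0 → Fin (suc m) → PTm 0
extend σ t zero    = t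
extend σ t (suc i) = σ i

inst-lift : ∀ {m} (σ : Fin m → PTm 0) t i → subT (λ _ → t) (lift σ i) ≡ extend σ t i
inst-lift σ t zero    = refl
inst-lift σ t (suc i) = trans (subT-renT (λ _ → t) suc (σ i)) (subT-closed _ (σ i))

inst-subF-lift : ∀ {P N m} (σ : Fin m → PTm 0) t (a : Fm P N (suc m)) →
  inst (subF (lift σ) a) t ≡ subF (extend σ t) a
inst-subF-lift σ t a = trans (subF-subF (λ _ → t) (lift σ) a) (subF-cong (inst-lift σ t) a)

inst-substX-lift : ∀ {A m} (σ : Fin m → PTm 0) t (a : Fm ⊤ ⊥ (suc m)) (θ : Fm A A 1) →
  inst (substX (lift σ) a θ) t ≡ substX (extend σ t) a θ
inst-substX-lift σ t a θ = trans (subF-substX (λ _ → t) (lift σ) a θ) (substX-cong (inst-lift σ t) a θ)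

subF-¬ᶠ : ∀ {A m k} (σ : Fin m → PTm k) (a : Fm A A m) → subF σ (¬ᶠ a) ≡ ¬ᶠ (subF σ a)
subF-¬ᶠ σ (s ≐ t)   = refl
subF-¬ᶠ σ (s ≠ t)   = refl
subF-¬ᶠ σ (pos p t) = refl
subF-¬ᶠ σ (neg p t) = refl
subF-¬ᶠ σ (a ∨ b)   = cong₂ _∧_ (subF-¬ᶠ σ a) (subF-¬ᶠ σ b)
subF-¬ᶠ σ (a ∧ b)   = cong₂ _∨_ (subF-¬ᶠ σ a) (subF-¬ᶠ σ b)
subF-¬ᶠ σ (∃' a)    = cong ∀' (subF-¬ᶠ (lift σ) a)
subF-¬ᶠ σ (∀' a)    = cong ∃' (subF-¬ᶠ (lift σ) a)

¬ᶠ-involutive : ∀ {A m} (a : Fm A A m) → ¬ᶠ (¬ᶠ a) ≡ a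
¬ᶠ-involutive (s ≐ t)   = refl
¬ᶠ-involutive (s ≠ t)   = refl
¬ᶠ-involutive (pos p t) = refl
¬ᶠ-involutive (neg p t) = refl
¬ᶠ-involutive (a ∨ b)   = cong₂ _∨_ (¬ᶠ-involutive a) (¬ᶠ-involutive b)
¬ᶠ-involutive (a ∧ b)   = cong₂ _∧_ (¬ᶠ-involutive a) (¬ᶠ-involutive b)
¬ᶠ-involutive (∃' a)    = cong ∃' (¬ᶠ-involutive a)
¬ᶠ-involutive (∀' a)    = cong ∀' (¬ᶠ-involutive a)

_≈⟦⟧_ : ∀ {m} → (Fin m → PTm 0) → (Fin m → PTm 0) → Set
σ ≈⟦⟧ σ′ = ∀ i → ⟦ σ i ⟧ ≡ ⟦ σ′ i ⟧

⟦subT⟧-cong : ∀ {m} {σ σ′ : Fin m → PTm 0} → σ ≈⟦⟧ σ′ → ∀ t → ⟦ subT σ t ⟧ ≡ ⟦ subT σ′ t ⟧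
⟦subT⟧-cong e (var i)  = e i
⟦subT⟧-cong e `0       = refl
⟦subT⟧-cong e (`S t)   = cong suc (⟦subT⟧-cong e t)
⟦subT⟧-cong e (s `+ t) = cong₂ _+_ (⟦subT⟧-cong e s) (⟦subT⟧-cong e t)
⟦subT⟧-cong e (s `* t) = cong₂ _*_ (⟦subT⟧-cong e s) (⟦subT⟧-cong e t)

⟦extend⟧-cong : ∀ {m} {σ σ′ : Fin m → PTm 0} → σ ≈⟦⟧ σ′ → ∀ t → extend σ t ≈⟦⟧ extend σ′ t
⟦extend⟧-cong e t zero    = refl
⟦extend⟧-cong e t (suc i) = e i

⟦numeral⟧ : ∀ n → ⟦ numeral n ⟧ ≡ n
⟦numeral⟧ zero    = refl
⟦numeral⟧ (suc n) = cong suc (⟦numeral⟧ n)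

toℕ-nat : ∀ m → toℕ (nat m) ≡ m
toℕ-nat m = length-replicate m

k-¬ᶠ : ∀ {m} (a : FmΩ m) → k (¬ᶠ a) ≡ k a
k-¬ᶠ (s ≐ t)   = refl
k-¬ᶠ (s ≠ t)   = refl
k-¬ᶠ (pos p t) = refl
k-¬ᶠ (neg p t) = refl
k-¬ᶠ (a ∨ b)   = cong₂ _++_ (k-¬ᶠ a) (k-¬ᶠ b)
k-¬ᶠ (a ∧ b)   = cong₂ _++_ (k-¬ᶠ a) (k-¬ᶠ b)
k-¬ᶠ (∃' a)    = k-¬ᶠ a
k-¬ᶠ (∀' a)    = k-¬ᶠ a

k-subF : ∀ {m l} (σ : Fin m → PTm l) (a : FmΩ m) → k (subF σ a) ≡ k a
k-subF σ (s ≐ t)   = refl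
k-subF σ (s ≠ t)   = refl
k-subF σ (pos p t) = refl
k-subF σ (neg p t) = refl
k-subF σ (a ∨ b)   = cong₂ _++_ (k-subF σ a) (k-subF σ b)
k-subF σ (a ∧ b)   = cong₂ _++_ (k-subF σ a) (k-subF σ b)
k-subF σ (∃' a)    = k-subF (lift σ) a
k-subF σ (∀' a)    = k-subF (lift σ) a

k-substX : ∀ {P : Tm → Set} {m l} (σ : Fin m → PTm l) (a : Fm ⊤ ⊥ m) (θ : FmΩ 1) →
  All P (k θ) → All P (k (substX σ a θ))
k-substX σ (s ≐ t)       θ pθ = []
k-substX σ (s ≠ t)       θ pθ = []
k-substX {P} σ (pos _ s) θ pθ = subst (All P) (sym (k-subF (λ _ → subT σ s) θ)) pθ
k-substX σ (a ∨ b)       θ pθ = ++⁺ (k-substX σ a θ pθ) (k-substX σ b θ pθ)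
k-substX σ (a ∧ b)       θ pθ = ++⁺ (k-substX σ a θ pθ) (k-substX σ b θ pθ)
k-substX σ (∃' a)        θ pθ = k-substX (lift σ) a θ pθ
k-substX σ (∀' a)        θ pθ = k-substX (lift σ) a θ pθ

k-plus : ∀ {m} (ψ : FmID m) → All (_≡ Ω) (k (plus ψ))
k-plus (s ≐ t)   = []
k-plus (s ≠ t)   = []
k-plus (pos p t) = refl ∷ []
k-plus (neg p t) = refl ∷ []
k-plus (a ∨ b)   = ++⁺ (k-plus a) (k-plus b)
k-plus (a ∧ b)   = ++⁺ (k-plus a) (k-plus b)
k-plus (∃' a)    = k-plus a
k-plus (∀' a)    = k-plus a

pick-cases : ∀ γ (a b : SentΩ) → (pick γ a b ≡ a) ⊎ (pick γ a b ≡ b)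
pick-cases Ω         a b = inj₂ refl
pick-cases (ϑ _)     a b = inj₂ refl
pick-cases ⟨ [] ⟩    a b = inj₁ refl
pick-cases ⟨ _ ∷ _ ⟩ a b = inj₂ refl

k-pick : ∀ {P : Tm → Set} γ {a b : SentΩ} → All P (k a) → All P (k b) → All P (k (pick γ a b))
k-pick {P} γ {a} {b} pa pb = [ (λ e → subst (λ x → All P (k x)) (sym e) pa)
                             , (λ e → subst (λ x → All P (k x)) (sym e) pb) ]′ (pick-cases γ a b)

k-fam : ∀ {P : Tm → Set} ψ γ → All P (k ψ) → P γ → All P (k (Junction.fam (junction ψ) γ))
k-fam (s ≐ t)          γ _  _  = []
k-fam (s ≠ t)          γ _  _  = []
k-fam (pos (φ , α) t)  γ _  pγ = k-substX (λ _ → t) φ (I φ γ) (pγ ∷ [])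
k-fam {P} (neg (φ , α) t) γ _ pγ =
  subst (All P) (sym (k-¬ᶠ (φ ⟪ t , I φ γ ⟫))) (k-substX (λ _ → t) φ (I φ γ) (pγ ∷ []))
k-fam (a ∨ b)          γ pψ _  = k-pick γ (proj₁ (++⁻ (k a) pψ)) (proj₂ (++⁻ (k a) pψ))
k-fam (a ∧ b)          γ pψ _  = k-pick γ (proj₁ (++⁻ (k a) pψ)) (proj₂ (++⁻ (k a) pψ))
k-fam {P} (∃' a)       γ pψ _  = subst (All P) (sym (k-subF _ a)) pψ
k-fam {P} (∀' a)       γ pψ _  = subst (All P) (sym (k-subF _ a)) pψ

wf-0 : WF (nat 0)
wf-0 = ⟨ [] ⟩ Desc.[] tt

Desc-∷zeros : ∀ c j → Desc (c ∷ replicate j (nat 0))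
Desc-∷zeros c zero    = Desc.[-]
Desc-∷zeros c (suc j) = 0⪯ c Desc.∷ Desc-∷zeros (nat 0) j

Es-zeros : ∀ m → Es (replicate m (nat 0)) ≡ []
Es-zeros zero    = refl
Es-zeros (suc m) = Es-zeros m

wf-nat : ∀ m → WF (nat m)
wf-nat zero    = wf-0
wf-nat (suc m) = ⟨ replicate⁺ (suc m) wf-0 ⟩ (Desc-∷zeros (nat 0) m) tt

nat≺ω : ∀ m → nat m ≺ ω
nat≺ω zero    = ⟨⟩≺⟨⟩ prefix
nat≺ω (suc m) = ⟨⟩≺⟨⟩ (here (⟨⟩≺⟨⟩ prefix))

0≺2 : nat 0 ≺ nat 2
0≺2 = ⟨⟩≺⟨⟩ prefix

1≺2 : nat 1 ≺ nat 2
1≺2 = ⟨⟩≺⟨⟩ (there prefix)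

NotPrincipalSingleton-∷∷ : ∀ a b l → NotPrincipalSingleton (a ∷ b ∷ l)
NotPrincipalSingleton-∷∷ Ω     _ _ = tt
NotPrincipalSingleton-∷∷ (ϑ _) _ _ = tt
NotPrincipalSingleton-∷∷ ⟨ _ ⟩ _ _ = tt

infix 4 _∈ᴴ_

_∈ᴴ_ : Tm → Op → Set
α ∈ᴴ G = WF α × G ∅ α

Controlled : Op → Sequent → Set
Controlled G Γ = All (λ ψ → All (_∈ᴴ G) (k ψ)) Γ

record Extends (G G′ : Op) : Set where
  constructor extends
  field ∈ᴴ-extends : ∀ {α} → α ∈ᴴ G → α ∈ᴴ G′
open Extends

Extends-refl : ∀ {G} → Extends G G
Extends-refl = extends λ α∈G → α∈G

Extends-trans : ∀ {G G′ G″} → Extends G G′ → Extends G′ G″ → Extends G G″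
Extends-trans e e′ = extends λ α∈G → ∈ᴴ-extends e′ (∈ᴴ-extends e α∈G)

Controlled-extends : ∀ {G G′ Γ} → Extends G G′ → Controlled G Γ → Controlled G′ Γ
Controlled-extends e = mapAll (mapAll (∈ᴴ-extends e))

Nice-[] : ∀ {G} → Nice G → ∀ γ → Nice (G [ γ ]ᴴ)
Nice-[] nG γ = record
  { inflationary = λ _ α w x → Nice.inflationary nG _ α w (inj₂ x)
  ; closure      = λ _ _ X⊆Y → Nice.closure nG _ _ λ
      { α w (inj₁ α≡γ) → Nice.inflationary nG _ α w (inj₁ α≡γ)
      ; α w (inj₂ x)   → X⊆Y α w x }
  ; E-closed₁    = λ _ → Nice.E-closed₁ nG _
  ; E-closed₂    = λ _ → Nice.E-closed₂ nG _
  }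

Extends-[] : ∀ {G} → Nice G → ∀ γ → Extends G (G [ γ ]ᴴ)
Extends-[] nG γ = extends λ { (w , g) → w , Nice.closure nG ∅ _ (λ _ _ ()) _ w g }

∈ᴴ-[] : ∀ {G γ} → Nice G → WF γ → γ ∈ᴴ (G [ γ ]ᴴ)
∈ᴴ-[] nG w = w , Nice.inflationary nG _ _ w (inj₁ refl)

∈ᴴ-E : ∀ {G α} → Nice G → WF α → All (G ∅) (E α) → α ∈ᴴ G
∈ᴴ-E nG w Eα∈G = w , Nice.E-closed₂ nG ∅ _ w Eα∈G

nat∈ᴴ : ∀ {G} → Nice G → ∀ m → nat m ∈ᴴ G
nat∈ᴴ nG m = ∈ᴴ-E nG (wf-nat m) (subst (All _) (sym (Es-zeros m)) [])

Ω∈ᴴ : ∀ {G} → Nice G → Ω ∈ᴴ G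
Ω∈ᴴ nG = ∈ᴴ-E nG Ω []

zeros-lex : ∀ j → Lex (replicate j (nat 0)) (replicate (suc j) (nat 0))
zeros-lex zero    = prefix
zeros-lex (suc j) = there (zeros-lex j)

E-∷zeros∈ᴴ : ∀ {G c} l → Nice G → c ∈ᴴ G → All (G ∅) (E c ++ Es (replicate l (nat 0)))
E-∷zeros∈ᴴ l nG (wc , gc) = ++⁺ (Nice.E-closed₁ nG ∅ _ wc gc) (subst (All _) (sym (Es-zeros l)) [])

-- ⟨α₀,…,αₙ₋₁⟩ denotes ω^α₀ + ⋯ + ω^αₙ₋₁.
infix 8 ω^_+_ Ω+ω^_+_

ω^_+_ : Tm → ℕ → Tm
ω^ c + j = ⟨ c ∷ replicate j (nat 0) ⟩

Ω+ω^_+_ : Tm → ℕ → Tm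
Ω+ω^ c + j = ⟨ Ω ∷ c ∷ replicate j (nat 0) ⟩

ω^+suc∈ᴴ : ∀ {G c} → Nice G → c ∈ᴴ G → ∀ j → ω^ c + suc j ∈ᴴ G
ω^+suc∈ᴴ {c = c} nG c∈G@(wc , _) j =
  ∈ᴴ-E nG (⟨ wc ∷ replicate⁺ (suc j) wf-0 ⟩ (Desc-∷zeros c (suc j)) (NotPrincipalSingleton-∷∷ c _ _))
    (E-∷zeros∈ᴴ (suc j) nG c∈G)

Ω+ω^+∈ᴴ : ∀ {G c} → Nice G → c ∈ᴴ G → c ⪯ Ω → ∀ j → Ω+ω^ c + j ∈ᴴ G
Ω+ω^+∈ᴴ {c = c} nG c∈G@(wc , _) c⪯Ω j =
  ∈ᴴ-E nG (⟨ Ω ∷ wc ∷ replicate⁺ j wf-0 ⟩ (c⪯Ω Desc.∷ Desc-∷zeros c j) tt) (E-∷zeros∈ᴴ j nG c∈G)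

record Heights (G : Op) (h : ℕ → Tm) : Set where
  field
    h∈ᴴ    : ∀ j → h j ∈ᴴ G
    h-step : ∀ j → h j ≺ h (suc j)
    nat≺h  : ∀ m j → nat m ≺ h j
open Heights

Heights-[] : ∀ {G h} → Nice G → Heights G h → ∀ γ → Heights (G [ γ ]ᴴ) h
Heights-[] nG hs γ = record
  { h∈ᴴ = λ j → ∈ᴴ-extends (Extends-[] nG γ) (h∈ᴴ hs j) ; h-step = h-step hs ; nat≺h = nat≺h hs }

Heights-ω^+suc : ∀ {G c} → Nice G → c ∈ᴴ G → nat 0 ≺ c → Heights G (λ j → ω^ c + suc j)
Heights-ω^+suc nG c∈G 0≺c = record
  { h∈ᴴ    = ω^+suc∈ᴴ nG c∈G
  ; h-step = λ j → ⟨⟩≺⟨⟩ (there (there (zeros-lex j)))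
  ; nat≺h  = λ { zero _ → ⟨⟩≺⟨⟩ prefix ; (suc _) _ → ⟨⟩≺⟨⟩ (here 0≺c) }
  }

Heights-Ω+ω^+ : ∀ {G c} → Nice G → c ∈ᴴ G → c ⪯ Ω → Heights G (Ω+ω^ c +_)
Heights-Ω+ω^+ nG c∈G c⪯Ω = record
  { h∈ᴴ    = Ω+ω^+∈ᴴ nG c∈G c⪯Ω
  ; h-step = λ j → ⟨⟩≺⟨⟩ (there (there (zeros-lex j)))
  ; nat≺h  = λ { zero _ → ⟨⟩≺⟨⟩ prefix ; (suc _) _ → ⟨⟩≺⟨⟩ (here ⟨⟩≺Ω) }
  }

kind : SentΩ → Kind
kind ψ = Junction.kind (junction ψ)

bound : SentΩ → Tm
bound ψ = Junction.bound (junction ψ)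

fam : SentΩ → Tm → SentΩ
fam ψ = Junction.fam (junction ψ)

Der< : Op → Tm → Sequent → Set₁
Der< G α Γ = Σ Tm λ β → WF β × β ≺ α × Der G β (nat 0) Γ

⋀-Premises : Op → Tm → Sequent → SentΩ → Set₁
⋀-Premises G α Γ ψ =
  ∀ γ → WF γ → γ ≺ bound ψ → Controlled (G [ γ ]ᴴ) (fam ψ γ ∷ Γ) → Der< (G [ γ ]ᴴ) α (fam ψ γ ∷ Γ)

admissible : ∀ {G α Γ} → Controlled G Γ → α ∈ᴴ G → Admissible G α Γ
admissible cΓ (wα , gα) = wα , gα , mapAll (mapAll proj₂) cΓ

module _ {G : Op} (nG : Nice G) where

  by-⋀ : ∀ {α Γ} ψ → Controlled G Γ → α ∈ᴴ G → ψ ∈ Γ → kind ψ ≡ conj → ⋀-Premises G α Γ ψ →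
    Der G α (nat 0) Γ
  by-⋀ ψ cΓ α∈G ψ∈Γ is-conj premise = ⋀-rule (admissible {G} cΓ α∈G) ψ∈Γ is-conj λ γ wγ γ≺ →
    premise γ wγ γ≺ (k-fam ψ γ (mapAll (∈ᴴ-extends (Extends-[] nG γ)) (lookup cΓ ψ∈Γ)) (∈ᴴ-[] nG wγ)
                     ∷ Controlled-extends (Extends-[] nG γ) cΓ)

  by-⋁ : ∀ {α Γ} ψ → Controlled G Γ → α ∈ᴴ G → ψ ∈ Γ → kind ψ ≡ disj →
    ∀ γ → γ ∈ᴴ G → γ ≺ bound ψ → γ ≺ α →
    (Controlled G (fam ψ γ ∷ Γ) → Der< G α (fam ψ γ ∷ Γ)) → Der G α (nat 0) Γ
  by-⋁ ψ cΓ α∈G ψ∈Γ is-disj γ γ∈G@(wγ , gγ) γ≺ γ≺α premise =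
    let β , wβ , β≺α , d = premise (k-fam ψ γ (lookup cΓ ψ∈Γ) γ∈G ∷ cΓ) in
    ⋁-rule (admissible {G} cΓ α∈G) ψ∈Γ is-disj γ wγ γ≺ γ≺α gγ β wβ β≺α d

module _ {G : Op} {h : ℕ → Tm} (nG : Nice G) (hs : Heights G h) where

  ⋀-step : ∀ j ψ {Γ} → Controlled G Γ → ψ ∈ Γ → kind ψ ≡ conj → ⋀-Premises G (h j) Γ ψ →
    Der< G (h (suc j)) Γ
  ⋀-step j ψ cΓ ψ∈Γ is-conj premise =
    h j , proj₁ (h∈ᴴ hs j) , h-step hs j , by-⋀ nG ψ cΓ (h∈ᴴ hs j) ψ∈Γ is-conj premise

  ⋁-step : ∀ j ψ {Γ} → Controlled G Γ → ψ ∈ Γ → kind ψ ≡ disj →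
    ∀ γ → γ ∈ᴴ G → γ ≺ bound ψ → γ ≺ h j →
    (Controlled G (fam ψ γ ∷ Γ) → Der< G (h j) (fam ψ γ ∷ Γ)) → Der< G (h (suc j)) Γ
  ⋁-step j ψ cΓ ψ∈Γ is-disj γ γ∈G γ≺ γ≺h premise =
    h j , proj₁ (h∈ᴴ hs j) , h-step hs j , by-⋁ nG ψ cΓ (h∈ᴴ hs j) ψ∈Γ is-disj γ γ∈G γ≺ γ≺h premise

  ∨ˡ-step : ∀ j {a b Γ} → Controlled G Γ → (a ∨ b) ∈ Γ →
    (Controlled G (a ∷ Γ) → Der< G (h j) (a ∷ Γ)) → Der< G (h (suc j)) Γ
  ∨ˡ-step j cΓ ∨∈Γ = ⋁-step j _ cΓ ∨∈Γ refl (nat 0) (nat∈ᴴ nG 0) 0≺2 (nat≺h hs 0 j)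

  ∨ʳ-step : ∀ j {a b Γ} → Controlled G Γ → (a ∨ b) ∈ Γ →
    (Controlled G (b ∷ Γ) → Der< G (h j) (b ∷ Γ)) → Der< G (h (suc j)) Γ
  ∨ʳ-step j cΓ ∨∈Γ = ⋁-step j _ cΓ ∨∈Γ refl (nat 1) (nat∈ᴴ nG 1) 1≺2 (nat≺h hs 1 j)

  ∃-step : ∀ j m {a Γ} → Controlled G Γ → ∃' a ∈ Γ →
    (Controlled G (inst a (numeral m) ∷ Γ) → Der< G (h j) (inst a (numeral m) ∷ Γ)) → Der< G (h (suc j)) Γ
  ∃-step j m {a} {Γ} cΓ ∃∈Γ premise =
    ⋁-step j (∃' a) cΓ ∃∈Γ refl (nat m) (nat∈ᴴ nG m) (nat≺ω m) (nat≺h hs m j)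
      (subst (λ n → Controlled G (inst a (numeral n) ∷ Γ) → Der< G (h j) (inst a (numeral n) ∷ Γ))
             (sym (toℕ-nat m)) premise)

  ∧-step : ∀ j {a b Γ} → Controlled G Γ → (a ∧ b) ∈ Γ →
    (∀ γ → Controlled (G [ γ ]ᴴ) (a ∷ Γ) → Der< (G [ γ ]ᴴ) (h j) (a ∷ Γ)) →
    (∀ γ → Controlled (G [ γ ]ᴴ) (b ∷ Γ) → Der< (G [ γ ]ᴴ) (h j) (b ∷ Γ)) →
    Der< G (h (suc j)) Γ
  ∧-step j {a} {b} {Γ} cΓ ∧∈Γ premise-a premise-b = ⋀-step j (a ∧ b) cΓ ∧∈Γ refl λ γ _ _ →
    [ (λ e → subst (P γ) (sym e) (premise-a γ)) , (λ e → subst (P γ) (sym e) (premise-b γ)) ]′ (pick-cases γ a b)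
    where
    P : Tm → SentΩ → Set₁
    P γ x = Controlled (G [ γ ]ᴴ) (x ∷ Γ) → Der< (G [ γ ]ᴴ) (h j) (x ∷ Γ)

true-literal : ∀ {G α Γ} → Nice G → Controlled G Γ → α ∈ᴴ G → ∀ {s t s′ t′} →
  ⟦ s ⟧ ≡ ⟦ s′ ⟧ → ⟦ t ⟧ ≡ ⟦ t′ ⟧ → (s ≠ t) ∈ Γ → (s′ ≐ t′) ∈ Γ → Der G α (nat 0) Γ
true-literal nG cΓ α∈G {s} {t} {s′} {t′} es et ≠∈Γ ≐∈Γ with ⟦ s ⟧ ≡ᵇ ⟦ t ⟧ in eq
... | true  = by-⋀ nG (s′ ≐ t′) cΓ α∈G ≐∈Γ ≐-conj λ _ _ γ≺0 _ → ⊥-elim (≮0 γ≺0)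
  where
  ≐-conj : kind (s′ ≐ t′) ≡ conj
  ≐-conj rewrite sym es | sym et | eq = refl
... | false = by-⋀ nG (s ≠ t) cΓ α∈G ≠∈Γ ≠-conj λ _ _ γ≺0 _ → ⊥-elim (≮0 γ≺0)
  where
  ≠-conj : kind (s ≠ t) ≡ conj
  ≠-conj rewrite eq = refl

-- d bounds the number of ⋀/⋁ inferences that reduce ¬a, b to L-leaves and true literals.
data Similar (L : SentΩ → SentΩ → Set) : ℕ → SentΩ → SentΩ → Set where
  leaf : ∀ {a b} → L a b → Similar L 0 a b
  ≐≐   : ∀ {s t s′ t′} → ⟦ s ⟧ ≡ ⟦ s′ ⟧ → ⟦ t ⟧ ≡ ⟦ t′ ⟧ → Similar L 0 (s ≐ t) (s′ ≐ t′)
  ≠≠   : ∀ {s t s′ t′} → ⟦ s ⟧ ≡ ⟦ s′ ⟧ → ⟦ t ⟧ ≡ ⟦ t′ ⟧ → Similar L 0 (s ≠ t) (s′ ≠ t′)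
  ∨∨   : ∀ {d₁ d₂ a₁ a₂ b₁ b₂} → Similar L d₁ a₁ b₁ → Similar L d₂ a₂ b₂ →
         Similar L (2 + (d₁ + d₂)) (a₁ ∨ a₂) (b₁ ∨ b₂)
  ∧∧   : ∀ {d₁ d₂ a₁ a₂ b₁ b₂} → Similar L d₁ a₁ b₁ → Similar L d₂ a₂ b₂ →
         Similar L (2 + (d₁ + d₂)) (a₁ ∧ a₂) (b₁ ∧ b₂)
  ∃∃   : ∀ {d a b} → (∀ m → Similar L d (inst a (numeral m)) (inst b (numeral m))) →
         Similar L (2 + d) (∃' a) (∃' b)
  ∀∀   : ∀ {d a b} → (∀ m → Similar L d (inst a (numeral m)) (inst b (numeral m))) →
         Similar L (2 + d) (∀' a) (∀' b)

-- Leaves are reached only after further inferences have enlarged both the operator and the sequent.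
ClosesLeaves : (SentΩ → SentΩ → Set) → (ℕ → Tm) → Op → Sequent → Set₁
ClosesLeaves L h G Γ = ∀ {G′ Γ′} → Nice G′ → Extends G G′ → Γ ⊆ˢ Γ′ → Controlled G′ Γ′ →
  ∀ {a b} → L a b → ¬ᶠ a ∈ Γ′ → b ∈ Γ′ → ∀ j → Der< G′ (h j) Γ′

ClosesLeaves-[] : ∀ {L h G Γ} → Nice G → ∀ γ {x y} →
  ClosesLeaves L h G Γ → ClosesLeaves L h (G [ γ ]ᴴ) (x ∷ y ∷ Γ)
ClosesLeaves-[] nG γ close nG′ e sub =
  close nG′ (Extends-trans (Extends-[] nG γ) e) (λ x∈Γ → sub (there (there x∈Γ)))

tautology : ∀ {L d a b G h Γ} → Similar L d a b → Nice G → Heights G h → Controlled G Γ →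
  ¬ᶠ a ∈ Γ → b ∈ Γ → ClosesLeaves L h G Γ → ∀ j → d ≤ j → Der< G (h j) Γ
tautology (leaf l)   nG _  cΓ ¬a∈Γ b∈Γ close j _ = close nG Extends-refl id cΓ l ¬a∈Γ b∈Γ j
tautology (≐≐ es et) nG hs cΓ ¬a∈Γ b∈Γ _ j _ =
  nat 0 , wf-0 , nat≺h hs 0 j , true-literal nG cΓ (nat∈ᴴ nG 0) es et ¬a∈Γ b∈Γ
tautology (≠≠ es et) nG hs cΓ ¬a∈Γ b∈Γ _ j _ =
  nat 0 , wf-0 , nat≺h hs 0 j , true-literal nG cΓ (nat∈ᴴ nG 0) (sym es) (sym et) b∈Γ ¬a∈Γ
tautology (∨∨ s₁ s₂) nG hs cΓ ¬a∈Γ b∈Γ close (suc (suc j)) (s≤s (s≤s d≤j)) =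
  ∧-step nG hs (suc j) cΓ ¬a∈Γ
    (λ γ cΓ′ → ∨ˡ-step (Nice-[] nG γ) (Heights-[] nG hs γ) j cΓ′ (there b∈Γ) λ cΓ″ →
      tautology s₁ (Nice-[] nG γ) (Heights-[] nG hs γ) cΓ″ (there (here refl)) (here refl)
        (ClosesLeaves-[] nG γ close) j (m+n≤o⇒m≤o _ d≤j))
    (λ γ cΓ′ → ∨ʳ-step (Nice-[] nG γ) (Heights-[] nG hs γ) j cΓ′ (there b∈Γ) λ cΓ″ →
      tautology s₂ (Nice-[] nG γ) (Heights-[] nG hs γ) cΓ″ (there (here refl)) (here refl)
        (ClosesLeaves-[] nG γ close) j (m+n≤o⇒n≤o _ d≤j))
tautology (∧∧ s₁ s₂) nG hs cΓ ¬a∈Γ b∈Γ close (suc (suc j)) (s≤s (s≤s d≤j)) =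
  ∧-step nG hs (suc j) cΓ b∈Γ
    (λ γ cΓ′ → ∨ˡ-step (Nice-[] nG γ) (Heights-[] nG hs γ) j cΓ′ (there ¬a∈Γ) λ cΓ″ →
      tautology s₁ (Nice-[] nG γ) (Heights-[] nG hs γ) cΓ″ (here refl) (there (here refl))
        (ClosesLeaves-[] nG γ close) j (m+n≤o⇒m≤o _ d≤j))
    (λ γ cΓ′ → ∨ʳ-step (Nice-[] nG γ) (Heights-[] nG hs γ) j cΓ′ (there ¬a∈Γ) λ cΓ″ →
      tautology s₂ (Nice-[] nG γ) (Heights-[] nG hs γ) cΓ″ (here refl) (there (here refl))
        (ClosesLeaves-[] nG γ close) j (m+n≤o⇒n≤o _ d≤j))
tautology (∃∃ {a = a} s) nG hs cΓ ¬a∈Γ b∈Γ close (suc (suc j)) (s≤s (s≤s d≤j)) =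
  ⋀-step nG hs (suc j) _ cΓ ¬a∈Γ refl λ γ _ _ cΓ′ →
    ∃-step (Nice-[] nG γ) (Heights-[] nG hs γ) j (toℕ γ) cΓ′ (there b∈Γ) λ cΓ″ →
      tautology (s (toℕ γ)) (Nice-[] nG γ) (Heights-[] nG hs γ) cΓ″ (there (here (sym (subF-¬ᶠ _ a))))
        (here refl) (ClosesLeaves-[] nG γ close) j d≤j
tautology (∀∀ {a = a} s) nG hs cΓ ¬a∈Γ b∈Γ close (suc (suc j)) (s≤s (s≤s d≤j)) =
  ⋀-step nG hs (suc j) _ cΓ b∈Γ refl λ γ _ _ cΓ′ →
    ∃-step (Nice-[] nG γ) (Heights-[] nG hs γ) j (toℕ γ) cΓ′ (there ¬a∈Γ) λ cΓ″ →
      tautology (s (toℕ γ)) (Nice-[] nG γ) (Heights-[] nG hs γ) cΓ″ (here (sym (subF-¬ᶠ _ a)))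
        (there (here refl)) (ClosesLeaves-[] nG γ close) j d≤j

data InstLeaves (θ₁ θ₂ : FmΩ 1) : SentΩ → SentΩ → Set where
  inst-leaves : ∀ {u₁ u₂} → ⟦ u₁ ⟧ ≡ ⟦ u₂ ⟧ → InstLeaves θ₁ θ₂ (inst θ₁ u₁) (inst θ₂ u₂)

data IΩ-Leaves : SentΩ → SentΩ → Set where
  pos-leaves : ∀ {φ u₁ u₂} → ⟦ u₁ ⟧ ≡ ⟦ u₂ ⟧ → IΩ-Leaves (pos (φ , Ω) u₁) (pos (φ , Ω) u₂)
  neg-leaves : ∀ {φ u₁ u₂} → ⟦ u₁ ⟧ ≡ ⟦ u₂ ⟧ → IΩ-Leaves (neg (φ , Ω) u₁) (neg (φ , Ω) u₂)

depth : ∀ {P N m} → Fm P N m → ℕ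
depth (_ ≐ _)   = 0
depth (_ ≠ _)   = 0
depth (pos _ _) = 0
depth (neg _ _) = 0
depth (a ∨ b)   = 2 + (depth a + depth b)
depth (a ∧ b)   = 2 + (depth a + depth b)
depth (∃' a)    = 2 + depth a
depth (∀' a)    = 2 + depth a

substX-similar : ∀ {m} (φ : Fm ⊤ ⊥ m) {σ₁ σ₂ : Fin m → PTm 0} → σ₁ ≈⟦⟧ σ₂ → ∀ θ₁ θ₂ →
  Similar (InstLeaves θ₁ θ₂) (depth φ) (substX σ₁ φ θ₁) (substX σ₂ φ θ₂)
substX-similar (s ≐ t)   e θ₁ θ₂ = ≐≐ (⟦subT⟧-cong e s) (⟦subT⟧-cong e t)
substX-similar (s ≠ t)   e θ₁ θ₂ = ≠≠ (⟦subT⟧-cong e s) (⟦subT⟧-cong e t)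
substX-similar (pos _ s) e θ₁ θ₂ = leaf (inst-leaves (⟦subT⟧-cong e s))
substX-similar (a ∨ b)   e θ₁ θ₂ = ∨∨ (substX-similar a e θ₁ θ₂) (substX-similar b e θ₁ θ₂)
substX-similar (a ∧ b)   e θ₁ θ₂ = ∧∧ (substX-similar a e θ₁ θ₂) (substX-similar b e θ₁ θ₂)
substX-similar (∃' a) {σ₁} {σ₂} e θ₁ θ₂ = ∃∃ λ m →
  subst₂ (Similar _ (depth a)) (sym (inst-substX-lift σ₁ (numeral m) a θ₁)) (sym (inst-substX-lift σ₂ (numeral m) a θ₂))
    (substX-similar a (⟦extend⟧-cong e (numeral m)) θ₁ θ₂)
substX-similar (∀' a) {σ₁} {σ₂} e θ₁ θ₂ = ∀∀ λ m →
  subst₂ (Similar _ (depth a)) (sym (inst-substX-lift σ₁ (numeral m) a θ₁)) (sym (inst-substX-lift σ₂ (numeral m) a θ₂))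
    (substX-similar a (⟦extend⟧-cong e (numeral m)) θ₁ θ₂)

plus-similar : ∀ {m} (ψ : FmID m) {σ₁ σ₂ : Fin m → PTm 0} → σ₁ ≈⟦⟧ σ₂ →
  Similar IΩ-Leaves (depth ψ) (subF σ₁ (plus ψ)) (subF σ₂ (plus ψ))
plus-similar (s ≐ t)   e = ≐≐ (⟦subT⟧-cong e s) (⟦subT⟧-cong e t)
plus-similar (s ≠ t)   e = ≠≠ (⟦subT⟧-cong e s) (⟦subT⟧-cong e t)
plus-similar (pos _ t) e = leaf (pos-leaves (⟦subT⟧-cong e t))
plus-similar (neg _ t) e = leaf (neg-leaves (⟦subT⟧-cong e t))
plus-similar (a ∨ b)   e = ∨∨ (plus-similar a e) (plus-similar b e)
plus-similar (a ∧ b)   e = ∧∧ (plus-similar a e) (plus-similar b e)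
plus-similar (∃' a) {σ₁} {σ₂} e = ∃∃ λ m →
  subst₂ (Similar _ (depth a)) (sym (inst-subF-lift σ₁ (numeral m) (plus a))) (sym (inst-subF-lift σ₂ (numeral m) (plus a)))
    (plus-similar a (⟦extend⟧-cong e (numeral m)))
plus-similar (∀' a) {σ₁} {σ₂} e = ∀∀ λ m →
  subst₂ (Similar _ (depth a)) (sym (inst-subF-lift σ₁ (numeral m) (plus a))) (sym (inst-subF-lift σ₂ (numeral m) (plus a)))
    (plus-similar a (⟦extend⟧-cong e (numeral m)))

Dominates : Tm → Tm → Set
Dominates c ε = ∀ {ε′} → ε′ ≺ ε → ε′ ≺ c × ω^ ε′ + 1 ≺ c

Dominates-ω^+1 : ∀ ε → Dominates (ω^ ε + 1) ε
Dominates-ω^+1 ε ε′≺ε = ≺head⇒≺⟨∷⟩ _ ε′≺ε , ⟨⟩≺⟨⟩ (here ε′≺ε)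

Dominates-Ω : Dominates Ω Ω
Dominates-Ω ε′≺Ω = ε′≺Ω , ⟨∷⟩≺Ω ε′≺Ω

-- ¬I^{≺ε}u₁, I^{≺ε}u₂: after ⋀ on ε′ ≺ ε and ⋁ with the same ε′, the two unfoldings φ(uᵢ, I^{≺ε′}) are
-- Similar, with leaves ¬I^{≺ε′}, I^{≺ε′} closed by induction on ε′.
I-identity : ∀ {ε c G Γ} (φ : OpForm) → Accessible ε → ε ⪯ Ω → Dominates c ε → nat 0 ≺ c →
  Nice G → c ∈ᴴ G → Controlled G Γ → ∀ {u₁ u₂} → ⟦ u₁ ⟧ ≡ ⟦ u₂ ⟧ →
  neg (φ , ε) u₁ ∈ Γ → pos (φ , ε) u₂ ∈ Γ → Der G (ω^ c + (2 + depth φ)) (nat 0) Γ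
I-identity {ε} {c} {G} φ (acc rs) ε⪯Ω dom 0≺c nG c∈G cΓ {u₂ = u₂} v neg∈Γ pos∈Γ =
  by-⋀ nG _ cΓ (h∈ᴴ hs (suc d)) neg∈Γ refl λ ε′ wε′ ε′≺ε cΓ′ →
    ⋁-step (Nice-[] nG ε′) (Heights-[] nG hs ε′) d (pos (φ , ε) u₂) cΓ′ (there pos∈Γ) refl
      ε′ (∈ᴴ-[] nG wε′) ε′≺ε (≺head⇒≺⟨∷⟩ _ (proj₁ (dom ε′≺ε))) λ cΓ″ →
      tautology (substX-similar φ (λ _ → v) (I φ ε′) (I φ ε′)) (Nice-[] nG ε′) (Heights-[] nG hs ε′) cΓ″
        (there (here refl)) (here refl) (close ε′ wε′ ε′≺ε) d ≤-refl
  where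
  d  = depth φ
  hs = Heights-ω^+suc nG c∈G 0≺c
  close : ∀ ε′ → WF ε′ → ε′ ≺ ε → ∀ {Γ′} →
    ClosesLeaves (InstLeaves (I φ ε′) (I φ ε′)) (λ j → ω^ c + suc j) (G [ ε′ ]ᴴ) Γ′
  close ε′ wε′ ε′≺ε nG′ e _ cΓ′ (inst-leaves v′) ¬a∈Γ′ b∈Γ′ _ =
    ω^ (ω^ ε′ + 1) + (2 + d) , proj₁ (ω^+suc∈ᴴ nG′ c′∈G′ (suc d)) , ⟨⟩≺⟨⟩ (here (proj₂ (dom ε′≺ε))) ,
    I-identity φ (rs ((wε′ , ε′≺Ω) , ε′≺ε)) (inj₁ ε′≺Ω) (Dominates-ω^+1 ε′) (⟨⟩≺⟨⟩ prefix)
      nG′ c′∈G′ cΓ′ v′ ¬a∈Γ′ b∈Γ′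
    where
    ε′≺Ω = ≺-trans-⪯Ω ε′≺ε ε⪯Ω
    c′∈G′ = ω^+suc∈ᴴ nG′ (∈ᴴ-extends e (∈ᴴ-[] nG wε′)) 0

IΩ-identity : ∀ {φ c G Γ u₁ u₂} → nat 0 ≺ c → Nice G → Controlled G Γ → ⟦ u₁ ⟧ ≡ ⟦ u₂ ⟧ →
  neg (φ , Ω) u₁ ∈ Γ → pos (φ , Ω) u₂ ∈ Γ → ∀ {j} → Der< G (Ω+ω^ c + j) Γ
IΩ-identity {φ} 0≺c nG cΓ v neg∈Γ pos∈Γ =
  ω^ Ω + (2 + depth φ) , proj₁ (ω^+suc∈ᴴ nG (Ω∈ᴴ nG) (suc (depth φ))) , ⟨⟩≺⟨⟩ (there (here 0≺c)) ,
  I-identity φ Ω-accessible (inj₂ refl) Dominates-Ω ⟨⟩≺Ω nG (Ω∈ᴴ nG) cΓ v neg∈Γ pos∈Γ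

-- The induction sentence

module InductionPrinciple (φ : OpForm) (ψ : FmID 1) where

  Ψ : FmΩ 1
  Ψ = plus ψ

  A : SentΩ
  A = ∀' ((φ ⟪ var zero , Ψ ⟫) ⇒ Ψ)

  N : ℕ
  N = depth φ + depth ψ

  closes-IΩ-leaves : ∀ {c G Γ} → nat 0 ≺ c → ClosesLeaves IΩ-Leaves (Ω+ω^ c +_) G Γ
  closes-IΩ-leaves 0≺c nG′ _ _ cΓ′ (pos-leaves v) ¬a∈Γ′ b∈Γ′ _ = IΩ-identity 0≺c nG′ cΓ′ v ¬a∈Γ′ b∈Γ′
  closes-IΩ-leaves 0≺c nG′ _ _ cΓ′ (neg-leaves v) ¬a∈Γ′ b∈Γ′ _ = IΩ-identity 0≺c nG′ cΓ′ (sym v) b∈Γ′ ¬a∈Γ′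

  mutual
    Ψ-contains-I< : ∀ {δ G Γ r r′} → Accessible δ → δ ≺ Ω → Nice G → δ ∈ᴴ G → Controlled G Γ →
      ¬ᶠ A ∈ Γ → ⟦ r ⟧ ≡ ⟦ r′ ⟧ → neg (φ , δ) r ∈ Γ → inst Ψ r′ ∈ Γ →
      Der G (Ω+ω^ (ω^ δ + 1) + (2 + N)) (nat 0) Γ
    Ψ-contains-I< {δ} (acc rs) δ≺Ω nG δ∈G cΓ ¬A∈Γ v neg∈Γ Ψ∈Γ =
      by-⋀ nG _ cΓ (h∈ᴴ hs (2 + N)) neg∈Γ refl λ ε wε ε≺δ cΓ′ →
        let ε≺Ω = ≺-trans-Ω ε≺δ δ≺Ω in
        Ψ-contains-φ[I<] (rs ((wε , ε≺Ω) , ε≺δ)) ε≺Ω c⪯Ω (⟨⟩≺⟨⟩ prefix) (⟨⟩≺⟨⟩ (here ε≺δ))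
          (Nice-[] nG ε) (∈ᴴ-[] nG wε) (∈ᴴ-extends (Extends-[] nG ε) c∈G) cΓ′ (there ¬A∈Γ)
          v (here refl) (there Ψ∈Γ)
      where
      c∈G = ω^+suc∈ᴴ nG δ∈G 0
      c⪯Ω = inj₁ (⟨∷⟩≺Ω δ≺Ω)
      hs  = Heights-Ω+ω^+ nG c∈G c⪯Ω

    Ψ-contains-φ[I<] : ∀ {δ c G Γ r r′} → Accessible δ → δ ≺ Ω → c ⪯ Ω → nat 0 ≺ c → ω^ δ + 1 ≺ c →
      Nice G → δ ∈ᴴ G → c ∈ᴴ G → Controlled G Γ → ¬ᶠ A ∈ Γ → ⟦ r ⟧ ≡ ⟦ r′ ⟧ →
      ¬ᶠ (φ ⟪ r , I φ δ ⟫) ∈ Γ → inst Ψ r′ ∈ Γ → Der< G (Ω+ω^ c + (2 + N)) Γ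
    Ψ-contains-φ[I<] {δ} {c} {G} {Γ} {r} acc-δ δ≺Ω c⪯Ω 0≺c δ+1≺c nG δ∈G c∈G cΓ ¬A∈Γ v φ∈Γ Ψ∈Γ =
      ∃-step nG hs (suc N) ⟦ r ⟧ cΓ ¬A∈Γ λ cΓ′ → ∧-step nG hs N cΓ′ (here refl)
        (λ γ cΓ″ → tautology (substX-similar φ (λ _ → sym (⟦numeral⟧ ⟦ r ⟧)) (I φ δ) Ψ)
           (Nice-[] nG γ) (Heights-[] nG hs γ) cΓ″ (there (there φ∈Γ)) (here ¬¬φ≡) (close-I<δ γ) N (m≤m+n _ _))
        (λ γ cΓ″ → tautology (plus-similar ψ (λ _ → trans (⟦numeral⟧ ⟦ r ⟧) v))
           (Nice-[] nG γ) (Heights-[] nG hs γ) cΓ″ (here (sym (subF-¬ᶠ _ Ψ))) (there (there Ψ∈Γ))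
           (closes-IΩ-leaves 0≺c) N (m≤n+m _ _))
      where
      hs = Heights-Ω+ω^+ nG c∈G c⪯Ω
      n̲ = numeral ⟦ r ⟧
      ¬¬φ≡ : φ ⟪ n̲ , Ψ ⟫ ≡ inst (¬ᶠ (¬ᶠ (φ ⟪ var zero , Ψ ⟫))) n̲
      ¬¬φ≡ = sym (trans (cong (λ θ → inst θ n̲) (¬ᶠ-involutive _))
                        (subF-substX (λ _ → n̲) (λ _ → var zero) φ Ψ))
      close-I<δ : ∀ γ {x y} → ClosesLeaves (InstLeaves (I φ δ) Ψ) (Ω+ω^ c +_) (G [ γ ]ᴴ) (x ∷ y ∷ Γ)
      close-I<δ γ nG′ e sub cΓ′ (inst-leaves v′) ¬a∈Γ′ b∈Γ′ _ =
        Ω+ω^ (ω^ δ + 1) + (2 + N) , proj₁ (Ω+ω^+∈ᴴ nG′ c′∈G′ (inj₁ (⟨∷⟩≺Ω δ≺Ω)) (2 + N)) ,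
        ⟨⟩≺⟨⟩ (there (here δ+1≺c)) ,
        Ψ-contains-I< acc-δ δ≺Ω nG′ δ∈G′ cΓ′ (sub (there (there ¬A∈Γ))) v′ ¬a∈Γ′ b∈Γ′
        where
        δ∈G′ = ∈ᴴ-extends e (∈ᴴ-extends (Extends-[] nG γ) δ∈G)
        c′∈G′ = ω^+suc∈ᴴ nG′ δ∈G′ 0

  k-IndSentence : All (_≡ Ω) (k (IndSentence φ ψ))
  k-IndSentence = ++⁺ (subst (All _) (sym (k-¬ᶠ A)) k-A) (refl ∷ k-plus ψ)
    where
    k-A : All (_≡ Ω) (k A)
    k-A = ++⁺ (subst (All _) (sym (k-¬ᶠ (φ ⟪ var zero , Ψ ⟫))) (k-substX (λ _ → var zero) φ Ψ (k-plus ψ)))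
              (k-plus ψ)

  IndSentence-derivable : ∀ {H} → Nice H → Der H (Ω·2+ (7 + N)) (nat 0) [ IndSentence φ ψ ]
  IndSentence-derivable {H} nH =
    by-⋁ nH _ cS (h∈ᴴ hs (7 + N)) (here refl) refl (nat 0) (nat∈ᴴ nH 0) 0≺2 (nat≺h hs 0 _) λ c₁ →
    ∨ʳ-step nH hs (6 + N) c₁ (there (here refl)) λ c₂ →
    ⋀-step nH hs (5 + N) _ c₂ (here refl) refl λ γ _ _ c₃ →
    let nH′ = Nice-[] nH γ ; hs′ = Heights-[] nH hs γ in
    ∨ˡ-step nH′ hs′ (4 + N) c₃ (here refl) λ c₄ →
    ∨ʳ-step nH′ hs′ (3 + N) c₄ (there (here refl)) λ c₅ →
    ⋀-step nH′ hs′ (2 + N) _ c₅ (there (here refl)) refl λ δ wδ δ≺Ω c₆ →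
    Ψ-contains-φ[I<] (BelowΩ⇒accessible δ (wδ , δ≺Ω)) δ≺Ω (inj₂ refl) ⟨⟩≺Ω (⟨∷⟩≺Ω δ≺Ω)
      (Nice-[] nH′ δ) (∈ᴴ-[] nH′ wδ) (Ω∈ᴴ (Nice-[] nH′ δ)) c₆
      (there (there (there (there (there (here refl)))))) refl (here refl) (there (here refl))
    where
    hs = Heights-Ω+ω^+ nH (Ω∈ᴴ nH) (inj₂ refl)
    cS : Controlled H [ IndSentence φ ψ ]
    cS = mapAll (λ { refl → Ω∈ᴴ nH }) k-IndSentence ∷ []

proposition6p4 : (H : Op) → Nice H → (φ : OpForm) → (ψ : FmID 1) →
    Σ ℕ (λ n → Der H (Ω·2+ n) (nat 0) [ IndSentence φ ψ ])
proposition6p4 H nH φ ψ = 7 + InductionPrinciple.N φ ψ , InductionPrinciple.IndSentence-derivable φ ψ nH
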